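{- Let $G$ be a finite connected multigraph and let $D_1,\dots,D_k$ be divisors on $G$. Then the Poincar\'e series $$P_{G,D_1,\dots,D_k}(z_1,\dots,z_k)=\sum_{(n_1,\dots,n_k)\in\mathbb{N}^k}\bigl(r_G(n_1D_1+\dots+n_kD_k)+1\bigr)z_1^{n_1}\cdots z_k^{n_k}$$ is rational: there exist polynomials $f,h\in\mathbb{Z}[z_1,\dots,z_k]$ such that $P_{G,D_1,\dots,D_k}(z_1,\dots,z_k)=f(z_1,\dots,z_k)/h(z_1,\dots,z_k)$ at every $(z_1,\dots,z_k)\in\mathbb{C}^k$ at which the series converges absolutely.
   Context: $\mathbb{N}$ denotes the set of non-negative integers. For a finite connected multigraph $G$ with vertex set $V(G)$, a divisor is an element $\sum_{u\in V(G)}a_u(u)$ of the free Abelian group ${\rm Div}(G)$ on $V(G)$; its degree is $\sum_u a_u$, and it is effective if all $a_u\ge 0$. For $f:V(G)\to\mathbb{Z}$, the principal divisor ${\rm div}(f)=\sum_{u}\bigl(\sum_{e=(u,v)\in E(G)}(f(u)-f(v))\bigr)(u)$ (sum over edges incident to $u$, with multiplicity). Two divisors are linearly equivalent if their difference is principal. The linear system $|D|$ is the set of effective divisors linearly equivalent to $D$. The rank $r_G(D)$ is $-1$ if $|D|=\emptyset$, and otherwise the largest integer $r$ such that $|D-E|\neq\emptyset$ for every effective divisor $E$ of degree $r$. -}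

module Defs where

open import Data.Nat as ℕ using (ℕ; zero; suc)
open import Data.Integer as ℤ using (ℤ; +_; -[1+_]; _+_; _*_; _-_; _≤_)
open import Data.Fin using (Fin)
open import Data.Vec as Vec using (Vec; []; _∷_)
open import Data.List as List using (List; []; _∷_)
open import Data.Product using (Σ; _×_; _,_; ∃)
open import Data.Sum using (_⊎_)
open import Data.Bool using (Bool; true; false; _∧_; if_then_else_)
open import Relation.Nullary using (¬_; does)
open import Relation.Binary.PropositionalEquality using (_≡_)
import Data.Vec.Properties as VecP

-- Finite multigraphs on vertex set Fin n (loops allowed; they do not
-- affect principal divisors).  mult u v = number of edges between u,v.

record Multigraph (n : ℕ) : Set where
  field
    mult : Fin n → Fin n → ℕ
    sym  : ∀ u v → mult u v ≡ mult v u
open Multigraph public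

data Reachable {n : ℕ} (G : Multigraph n) : Fin n → Fin n → Set where
  here : ∀ {u} → Reachable G u u
  step : ∀ {u v w} → ℕ.NonZero (mult G u v) → Reachable G v w → Reachable G u w

Connected : ∀ {n} → Multigraph n → Set
Connected G = ∀ u v → Reachable G u v

Divisor : ℕ → Set
Divisor n = Fin n → ℤ

sumFin : ∀ {n} → (Fin n → ℤ) → ℤ
sumFin {zero}  f = + 0
sumFin {suc n} f = f Fin.zero + sumFin {n} (λ i → f (Fin.suc i))
  where import Data.Fin as Fin

deg : ∀ {n} → Divisor n → ℤ
deg = sumFin

Effective : ∀ {n} → Divisor n → Set
Effective D = ∀ u → + 0 ≤ D u

_-D_ : ∀ {n} → Divisor n → Divisor n → Divisor n
(D -D E) u = D u - E u

div : ∀ {n} → Multigraph n → (Fin n → ℤ) → Divisor n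
div G f u = sumFin (λ v → + mult G u v * (f u - f v))

LinEquiv : ∀ {n} → Multigraph n → Divisor n → Divisor n → Set
LinEquiv G D D′ = ∃ λ (f : Fin _ → ℤ) → ∀ u → (D -D D′) u ≡ div G f u

LinSysNonEmpty : ∀ {n} → Multigraph n → Divisor n → Set
LinSysNonEmpty G D = ∃ λ E → Effective E × LinEquiv G E D

RankAtLeast : ∀ {n} → Multigraph n → Divisor n → ℕ → Set
RankAtLeast G D s = ∀ E → Effective E → deg E ≡ + s → LinSysNonEmpty G (D -D E)

HasRank : ∀ {n} → Multigraph n → Divisor n → ℤ → Set
HasRank G D r =
  (r ≡ -[1+ 0 ] × ¬ LinSysNonEmpty G D)
  ⊎ (Σ ℕ λ s → r ≡ + s × LinSysNonEmpty G D × RankAtLeast G D s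
        × (∀ t → RankAtLeast G D t → t ℕ.≤ s))

linComb : ∀ {n k} → Vec ℕ k → Vec (Divisor n) k → Divisor n
linComb []       []       u = + 0
linComb (m ∷ ms) (D ∷ Ds) u = + m * D u + linComb ms Ds u

Series : ℕ → Set
Series k = Vec ℕ k → ℤ

Poly : ℕ → Set
Poly k = List (ℤ × Vec ℕ k)

_==V_ : ∀ {k} → Vec ℕ k → Vec ℕ k → Bool
x ==V y = does (VecP.≡-dec ℕ._≟_ x y)

_≤V_ : ∀ {k} → Vec ℕ k → Vec ℕ k → Bool
[] ≤V [] = true
(x ∷ xs) ≤V (y ∷ ys) = does (x ℕ.≤? y) ∧ (xs ≤V ys)

_∸V_ : ∀ {k} → Vec ℕ k → Vec ℕ k → Vec ℕ k
x ∸V y = Vec.zipWith ℕ._∸_ x y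

coeff : ∀ {k} → Poly k → Vec ℕ k → ℤ
coeff []             e = + 0
coeff ((c , m) ∷ ps) e = (if m ==V e then c else + 0) + coeff ps e

mulCoeff : ∀ {k} → Poly k → Series k → Vec ℕ k → ℤ
mulCoeff []             a e = + 0
mulCoeff ((c , m) ∷ ps) a e =
  (if m ≤V e then c * a (e ∸V m) else + 0) + mulCoeff ps a e

zeroV : ∀ {k} → Vec ℕ k
zeroV = Vec.replicate _ 0

-- The rank is constant on linear equivalence classes, equals -1 in negative
-- degree, and equals deg D - g once deg D is large: a divisor of degree ≥ g is
-- equivalent to an effective one (Dhar's burning algorithm applied to a reduced
-- divisor), while the orientation divisor ν of degree g - 1 has empty linear
-- system. Moreover every divisor of degree 0 is torsion, by pigeonhole on the
-- finitely many effective divisors of a fixed degree. Slicing the rank series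
-- along its first variable, with D₁ the first divisor: if deg D₁ = 0 the series
-- is periodic in that variable; if some Dⱼ has degree of the opposite sign, it is
-- periodic along a vector supported on the two variables; otherwise it is
-- eventually affine (deg D₁ > 0) or eventually zero (deg D₁ < 0) in it. In every
-- case a polynomial with nonzero constant term multiplies the series into a finite
-- combination of slices, which are rank series in fewer variables.

module Submission where

open import Defs renaming (sym to mult-sym)
open import Data.Nat as ℕ using (ℕ; zero; suc; z≤n; s≤s)
import Data.Nat.Properties as ℕP
open import Data.Integer as ℤ using (ℤ; +_; -[1+_]; _+_; _*_; _-_; -_; _≤_; _<_; ∣_∣)
import Data.Integer.Properties as ℤP
open import Data.Integer.Tactic.RingSolver using (solve-∀)
open import Data.Fin as Fin using (Fin; zero; suc; toℕ)
import Data.Fin.Properties as FinP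
open import Data.Fin.Subset using (Subset)
open import Data.Fin.Subset.Properties using (anySubset?)
open import Data.Bool as Bool using (Bool; true; false; if_then_else_; _∧_; _∨_; not; T)
import Data.Bool.Properties as BoolP
open import Data.Vec as Vec using (Vec; []; _∷_; lookup; insertAt; removeAt; _[_]≔_)
import Data.Vec.Properties as VecP
open import Data.List using (List; []; _∷_; _++_)
open import Data.Product using (Σ; _×_; _,_; ∃; proj₁; proj₂)
open import Data.Sum using (_⊎_; inj₁; inj₂)
open import Data.Empty using (⊥-elim)
open import Relation.Nullary using (¬_; Dec; yes; no; does; contradiction; _×-dec_; _→-dec_)
open import Relation.Nullary.Decidable using (dec-true; dec-false)
open import Relation.Binary using (tri<; tri≈; tri>)
open import Relation.Binary.PropositionalEquality
open import Function using (_∘_)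

-- Inequalities are proved by exhibiting b - a as a sum of evidently
-- nonnegative terms; the identity itself is left to the ring solver.
≤-by-diff : ∀ {a b c : ℤ} → b - a ≡ c → + 0 ≤ c → a ≤ b
≤-by-diff eq 0≤c = ℤP.0≤i-j⇒j≤i (ℤP.≤-trans 0≤c (ℤP.≤-reflexive (sym eq)))

<-by-diff : ∀ {a b c : ℤ} → b - (a + + 1) ≡ c → + 0 ≤ c → a < b
<-by-diff {a} eq 0≤c = ℤP.suc[i]≤j⇒i<j (subst (_≤ _) (ℤP.+-comm a (+ 1)) (≤-by-diff eq 0≤c))

<⇒+1≤ : ∀ {a b : ℤ} → a < b → a + + 1 ≤ b
<⇒+1≤ {a} a<b = subst (_≤ _) (ℤP.+-comm (+ 1) a) (ℤP.i<j⇒suc[i]≤j a<b)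

0≤+ : ∀ x → + 0 ≤ + x
0≤+ x = ℤ.+≤+ z≤n

0≤-* : ∀ {a b : ℤ} → + 0 ≤ a → + 0 ≤ b → + 0 ≤ a * b
0≤-* {+ x} {+ y} _ _ = subst (+ 0 ≤_) (ℤP.pos-* x y) (0≤+ _)

-∣i∣≤i : ∀ (x : ℤ) → - + ∣ x ∣ ≤ x
-∣i∣≤i (+ x)    = ℤP.≤-trans (ℤP.neg-mono-≤ (0≤+ x)) (0≤+ x)
-∣i∣≤i -[1+ x ] = ℤP.≤-refl

i≤∣i∣ : ∀ (x : ℤ) → x ≤ + ∣ x ∣
i≤∣i∣ (+ x)    = ℤP.≤-refl
i≤∣i∣ -[1+ x ] = ℤ.-≤+

∣i∣≡-i : ∀ {x : ℤ} → x < + 0 → + ∣ x ∣ ≡ - x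
∣i∣≡-i { -[1+ x ]} _          = refl
∣i∣≡-i {+ x}      (ℤ.+<+ ())

sumFin-cong : ∀ {n} {f g : Fin n → ℤ} → (∀ i → f i ≡ g i) → sumFin f ≡ sumFin g
sumFin-cong {zero}  f≗g = refl
sumFin-cong {suc n} f≗g = cong₂ _+_ (f≗g zero) (sumFin-cong (λ i → f≗g (suc i)))

sumFin-zero : ∀ n → sumFin {n} (λ _ → + 0) ≡ + 0
sumFin-zero zero    = refl
sumFin-zero (suc n) = trans (ℤP.+-identityˡ _) (sumFin-zero n)

sumFin-+ : ∀ {n} (f g : Fin n → ℤ) → sumFin (λ i → f i + g i) ≡ sumFin f + sumFin g
sumFin-+ {zero}  f g = refl
sumFin-+ {suc n} f g = trans (cong (_+_ (f zero + g zero)) (sumFin-+ (λ i → f (suc i)) (λ i → g (suc i))))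
                             (interchange (f zero) (g zero) _ _)
  where
  interchange : ∀ a b c d → (a + b) + (c + d) ≡ (a + c) + (b + d)
  interchange = solve-∀

sumFin-*ˡ : ∀ {n} (c : ℤ) (f : Fin n → ℤ) → sumFin (λ i → c * f i) ≡ c * sumFin f
sumFin-*ˡ {zero}  c f = sym (ℤP.*-zeroʳ c)
sumFin-*ˡ {suc n} c f = trans (cong (_+_ (c * f zero)) (sumFin-*ˡ c (λ i → f (suc i))))
                              (sym (ℤP.*-distribˡ-+ c (f zero) _))

sumFin-neg : ∀ {n} (f : Fin n → ℤ) → sumFin (λ i → - f i) ≡ - sumFin f
sumFin-neg {zero}  f = refl
sumFin-neg {suc n} f = trans (cong (_+_ (- f zero)) (sumFin-neg (λ i → f (suc i))))
                             (sym (ℤP.neg-distrib-+ (f zero) _))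

sumFin-- : ∀ {n} (f g : Fin n → ℤ) → sumFin (λ i → f i - g i) ≡ sumFin f - sumFin g
sumFin-- f g = trans (sumFin-+ f (λ i → - g i)) (cong (_+_ (sumFin f)) (sumFin-neg g))

sumFin-comm : ∀ {n m} (F : Fin n → Fin m → ℤ) →
  sumFin (λ i → sumFin (F i)) ≡ sumFin (λ j → sumFin (λ i → F i j))
sumFin-comm {zero}  {m} F = sym (sumFin-zero m)
sumFin-comm {suc n} {m} F =
  trans (cong (_+_ (sumFin (F zero))) (sumFin-comm (λ i → F (suc i))))
        (sym (sumFin-+ (F zero) (λ j → sumFin (λ i → F (suc i) j))))

sumFin-mono-≤ : ∀ {n} {f g : Fin n → ℤ} → (∀ i → f i ≤ g i) → sumFin f ≤ sumFin g
sumFin-mono-≤ {zero}  f≤g = ℤP.≤-refl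
sumFin-mono-≤ {suc n} f≤g = ℤP.+-mono-≤ (f≤g zero) (sumFin-mono-≤ (λ i → f≤g (suc i)))

sumFin-nonneg : ∀ {n} {f : Fin n → ℤ} → (∀ i → + 0 ≤ f i) → + 0 ≤ sumFin f
sumFin-nonneg {n} {f} 0≤f = subst (_≤ sumFin f) (sumFin-zero n) (sumFin-mono-≤ {f = λ _ → + 0} 0≤f)

≤-sumFin : ∀ {n} {f : Fin n → ℤ} → (∀ i → + 0 ≤ f i) → ∀ j → f j ≤ sumFin f
≤-sumFin {suc n} {f} 0≤f zero =
  ℤP.≤-trans (ℤP.≤-reflexive (sym (ℤP.+-identityʳ (f zero))))
             (ℤP.+-monoʳ-≤ (f zero) (sumFin-nonneg (λ i → 0≤f (suc i))))
≤-sumFin {suc n} {f} 0≤f (suc j) =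
  ℤP.≤-trans (≤-sumFin (λ i → 0≤f (suc i)) j)
             (ℤP.≤-trans (ℤP.≤-reflexive (sym (ℤP.+-identityˡ _))) (ℤP.+-monoˡ-≤ _ (0≤f zero)))

sumFin-const : ∀ n (c : ℤ) → sumFin {n} (λ _ → c) ≡ + n * c
sumFin-const zero    c = sym (ℤP.*-zeroˡ c)
sumFin-const (suc n) c = trans (cong (_+_ c) (sumFin-const n c)) (sym (ℤP.suc-* (+ n) c))

infixr 7 ⟦_⟧_
⟦_⟧_ : Bool → ℤ → ℤ
⟦ b ⟧ x = if b then x else + 0

⟦⟧-zero : ∀ b → ⟦ b ⟧ + 0 ≡ + 0
⟦⟧-zero true  = refl
⟦⟧-zero false = refl

⟦⟧-+ : ∀ b x y → ⟦ b ⟧ x + ⟦ b ⟧ y ≡ ⟦ b ⟧ (x + y)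
⟦⟧-+ true  x y = refl
⟦⟧-+ false x y = refl

sumFin-select : ∀ {n} (w : Fin n) (f : Fin n → ℤ) → sumFin (λ i → ⟦ does (i Fin.≟ w) ⟧ f i) ≡ f w
sumFin-select {suc n} zero f =
  trans (cong (_+_ (f zero)) (trans (sumFin-cong {n} {g = λ _ → + 0} (λ i → refl)) (sumFin-zero n))) (ℤP.+-identityʳ _)
sumFin-select {suc n} (suc w) f =
  trans (ℤP.+-identityˡ (sumFin (λ i → ⟦ does (suc i Fin.≟ suc w) ⟧ f (suc i))))
        (trans (sumFin-cong skip) (sumFin-select w (λ i → f (suc i))))
  where
  skip : ∀ i → ⟦ does (suc i Fin.≟ suc w) ⟧ f (suc i) ≡ ⟦ does (i Fin.≟ w) ⟧ f (suc i)
  skip i with i Fin.≟ w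
  ... | yes _ = refl
  ... | no  _ = refl

sumFin-⟦⟧ : ∀ {n} b (f : Fin n → ℤ) → sumFin (λ i → ⟦ b ⟧ f i) ≡ ⟦ b ⟧ sumFin f
sumFin-⟦⟧ true      f = refl
sumFin-⟦⟧ {n} false f = sumFin-zero n

0≤⟦⟧ : ∀ b {x} → + 0 ≤ x → + 0 ≤ ⟦ b ⟧ x
0≤⟦⟧ true  0≤x = 0≤x
0≤⟦⟧ false _   = ℤP.≤-refl

module _ {n : ℕ} (G : Multigraph n) where

  div-+ : ∀ (f h : Fin n → ℤ) u → div G (λ v → f v + h v) u ≡ div G f u + div G h u
  div-+ f h u = trans (sumFin-cong (λ v → distrib (+ mult G u v) (f u) (h u) (f v) (h v))) (sumFin-+ {n} _ _)
    where
    distrib : ∀ a b c d e → a * ((b + c) - (d + e)) ≡ a * (b - d) + a * (c - e)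
    distrib = solve-∀

  div-*ˡ : ∀ (c : ℤ) (f : Fin n → ℤ) u → div G (λ v → c * f v) u ≡ c * div G f u
  div-*ˡ c f u = trans (sumFin-cong (λ v → swap (+ mult G u v) c (f u) (f v))) (sumFin-*ˡ {n} c _)
    where
    swap : ∀ a c x y → a * (c * x - c * y) ≡ c * (a * (x - y))
    swap = solve-∀

  div-neg : ∀ (f : Fin n → ℤ) u → div G (λ v → - f v) u ≡ - div G f u
  div-neg f u = trans (sumFin-cong (λ v → neg (+ mult G u v) (f u) (f v))) (sumFin-neg {n} _)
    where
    neg : ∀ a x y → a * (- x - - y) ≡ - (a * (x - y))
    neg = solve-∀

  div-const : ∀ (c : ℤ) u → div G (λ _ → c) u ≡ + 0
  div-const c u = trans (sumFin-cong (λ v → vanish (+ mult G u v) c)) (sumFin-zero n)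
    where
    vanish : ∀ a c → a * (c - c) ≡ + 0
    vanish = solve-∀

  -- The Laplacian is symmetric because the multiplicity matrix is.
  div-selfAdjoint : ∀ (ψ h : Fin n → ℤ) →
    sumFin (λ v → ψ v * div G h v) ≡ sumFin (λ v → h v * div G ψ v)
  div-selfAdjoint ψ h = begin
    sumFin (λ v → ψ v * div G h v)
      ≡⟨ expand ψ h ⟩
    sumFin (λ v → sumFin (λ x → + mult G v x * (ψ v * h v))) - sumFin (λ v → sumFin (λ x → + mult G v x * (ψ v * h x)))
      ≡⟨ cong₂ _-_ (sumFin-cong (λ v → sumFin-cong (λ x → cong (+ mult G v x *_) (ℤP.*-comm (ψ v) (h v))))) swapped ⟩
    sumFin (λ v → sumFin (λ x → + mult G v x * (h v * ψ v))) - sumFin (λ v → sumFin (λ x → + mult G v x * (h v * ψ x)))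
      ≡⟨ expand h ψ ⟨
    sumFin (λ v → h v * div G ψ v) ∎
    where
    open ≡-Reasoning
    distrib : ∀ p a b c → p * (a * (b - c)) ≡ a * (p * b) - a * (p * c)
    distrib = solve-∀
    expand : ∀ (φ χ : Fin n → ℤ) → sumFin (λ v → φ v * div G χ v)
      ≡ sumFin (λ v → sumFin (λ x → + mult G v x * (φ v * χ v))) - sumFin (λ v → sumFin (λ x → + mult G v x * (φ v * χ x)))
    expand φ χ =
      trans (sumFin-cong (λ v → trans (sym (sumFin-*ˡ {n} (φ v) _)) (sumFin-cong (λ x → distrib (φ v) (+ mult G v x) (χ v) (χ x)))))
            (trans (sumFin-cong (λ v → sumFin-- (λ x → + mult G v x * (φ v * χ v)) (λ x → + mult G v x * (φ v * χ x))))
                   (sumFin-- {n} _ _))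
    swapped : sumFin (λ v → sumFin (λ x → + mult G v x * (ψ v * h x)))
            ≡ sumFin (λ v → sumFin (λ x → + mult G v x * (h v * ψ x)))
    swapped = trans (sumFin-comm (λ v x → + mult G v x * (ψ v * h x)))
                    (sumFin-cong (λ x → sumFin-cong (λ v → cong₂ _*_ (cong +_ (mult-sym G v x)) (ℤP.*-comm (ψ v) (h x)))))

  deg-div : ∀ (f : Fin n → ℤ) → deg (div G f) ≡ + 0
  deg-div f = begin
    sumFin (div G f)                         ≡⟨ sumFin-cong (λ v → sym (ℤP.*-identityˡ (div G f v))) ⟩
    sumFin (λ v → + 1 * div G f v)           ≡⟨ div-selfAdjoint (λ _ → + 1) f ⟩
    sumFin (λ v → f v * div G (λ _ → + 1) v) ≡⟨ sumFin-cong (λ v → trans (cong (f v *_) (div-const (+ 1) v))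
                                                                      (ℤP.*-zeroʳ (f v))) ⟩
    sumFin {n} (λ _ → + 0)                   ≡⟨ sumFin-zero n ⟩
    + 0                                      ∎
    where open ≡-Reasoning

-- A record version of LinEquiv, so that both divisors can be inferred.
infix 4 _∼[_]_
record _∼[_]_ {n} (D : Divisor n) (G : Multigraph n) (D′ : Divisor n) : Set where
  constructor mk∼
  field
    potential  : Fin n → ℤ
    D-D′≡div   : ∀ u → D u - D′ u ≡ div G potential u
open _∼[_]_ public

module _ {n : ℕ} {G : Multigraph n} where

  LinEquiv⇒∼ : ∀ {D D′ : Divisor n} → LinEquiv G D D′ → D ∼[ G ] D′
  LinEquiv⇒∼ (f , eq) = mk∼ f eq

  ∼⇒LinEquiv : ∀ {D D′ : Divisor n} → D ∼[ G ] D′ → LinEquiv G D D′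
  ∼⇒LinEquiv (mk∼ f eq) = f , eq

  ∼-intro : ∀ {D D′ : Divisor n} (f : Fin n → ℤ) → (∀ u → D u ≡ D′ u + div G f u) → D ∼[ G ] D′
  ∼-intro {D} {D′} f eq = mk∼ f λ u → trans (cong (_- D′ u) (eq u)) (cancel (D′ u) (div G f u))
    where
    cancel : ∀ a b → (a + b) - a ≡ b
    cancel = solve-∀

  ∼-elim : ∀ {D D′ : Divisor n} (D∼D′ : D ∼[ G ] D′) → ∀ u → D u ≡ D′ u + div G (potential D∼D′) u
  ∼-elim {D} {D′} (mk∼ f eq) u = trans (split (D u) (D′ u)) (cong (_+_ (D′ u)) (eq u))
    where
    split : ∀ a b → a ≡ b + (a - b)
    split = solve-∀

  ≗⇒∼ : ∀ {D D′ : Divisor n} → (∀ u → D u ≡ D′ u) → D ∼[ G ] D′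
  ≗⇒∼ {D} {D′} D≗D′ = ∼-intro (λ _ → + 0) λ u →
    trans (D≗D′ u) (sym (trans (cong (_+_ (D′ u)) (div-const G (+ 0) u)) (ℤP.+-identityʳ _)))

  ∼-sym : ∀ {D D′ : Divisor n} → D ∼[ G ] D′ → D′ ∼[ G ] D
  ∼-sym {D} {D′} (mk∼ f eq) = ∼-intro (λ v → - f v) λ u →
    trans (flip (D u) (D′ u)) (trans (cong (λ x → D u + - x) (eq u)) (cong (_+_ (D u)) (sym (div-neg G f u))))
    where
    flip : ∀ a b → b ≡ a + - (a - b)
    flip = solve-∀

  ∼-trans : ∀ {D D′ D″ : Divisor n} → D ∼[ G ] D′ → D′ ∼[ G ] D″ → D ∼[ G ] D″
  ∼-trans {D} {D′} {D″} p q = ∼-intro (λ v → potential p v + potential q v) λ u → begin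
    D u                                                       ≡⟨ ∼-elim p u ⟩
    D′ u + div G (potential p) u                              ≡⟨ cong (_+ div G (potential p) u) (∼-elim q u) ⟩
    (D″ u + div G (potential q) u) + div G (potential p) u    ≡⟨ reassoc (D″ u) _ _ ⟩
    D″ u + (div G (potential p) u + div G (potential q) u)    ≡⟨ cong (_+_ (D″ u)) (div-+ G (potential p) (potential q) u) ⟨
    D″ u + div G (λ v → potential p v + potential q v) u      ∎
    where
    open ≡-Reasoning
    reassoc : ∀ a b c → (a + b) + c ≡ a + (c + b)
    reassoc = solve-∀

  ∼-from-difference : ∀ {D D′ X Y : Divisor n} → (∀ u → X u - Y u ≡ D u - D′ u) → D ∼[ G ] D′ → X ∼[ G ] Y
  ∼-from-difference eq (mk∼ f D-D′) = mk∼ f λ u → trans (eq u) (D-D′ u)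

  deg-resp-∼ : ∀ {D D′ : Divisor n} → D ∼[ G ] D′ → deg D ≡ deg D′
  deg-resp-∼ {D} {D′} (mk∼ f eq) = begin
    deg D                          ≡⟨ split (deg D) (deg D′) ⟩
    deg D′ + (deg D - deg D′)      ≡⟨ cong (_+_ (deg D′)) (sym (sumFin-- D D′)) ⟩
    deg D′ + sumFin (D -D D′)      ≡⟨ cong (_+_ (deg D′)) (trans (sumFin-cong eq) (deg-div G f)) ⟩
    deg D′ + + 0                   ≡⟨ ℤP.+-identityʳ _ ⟩
    deg D′                         ∎
    where
    open ≡-Reasoning
    split : ∀ a b → a ≡ b + (a - b)
    split = solve-∀

module _ {n : ℕ} {G : Multigraph n} where

  linSys-resp-∼ : ∀ {D D′ : Divisor n} → D ∼[ G ] D′ → LinSysNonEmpty G D → LinSysNonEmpty G D′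
  linSys-resp-∼ {D} D∼D′ (E , effE , E∼D) =
    E , effE , ∼⇒LinEquiv (∼-trans (LinEquiv⇒∼ {G = G} {D = E} {D′ = D} E∼D) D∼D′)

  rankAtLeast-resp-∼ : ∀ {D D′ : Divisor n} {s} → D ∼[ G ] D′ → RankAtLeast G D s → RankAtLeast G D′ s
  rankAtLeast-resp-∼ {D} {D′} D∼D′ rD E effE degE =
    linSys-resp-∼ (∼-from-difference (λ u → cancel (D u) (D′ u) (E u)) D∼D′) (rD E effE degE)
    where
    cancel : ∀ a b c → (a - c) - (b - c) ≡ a - b
    cancel = solve-∀

  hasRank-resp-∼ : ∀ {D D′ : Divisor n} {r} → D ∼[ G ] D′ → HasRank G D r → HasRank G D′ r
  hasRank-resp-∼ D∼D′ (inj₁ (r≡-1 , empty)) = inj₁ (r≡-1 , λ ne → empty (linSys-resp-∼ (∼-sym D∼D′) ne))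
  hasRank-resp-∼ D∼D′ (inj₂ (s , r≡s , ne , atLeast , maximal)) =
    inj₂ (s , r≡s , linSys-resp-∼ D∼D′ ne , rankAtLeast-resp-∼ D∼D′ atLeast ,
          λ t rt → maximal t (rankAtLeast-resp-∼ (∼-sym D∼D′) rt))

  hasRank-resp-≗ : ∀ {D D′ : Divisor n} {r} → (∀ u → D u ≡ D′ u) → HasRank G D r → HasRank G D′ r
  hasRank-resp-≗ D≗D′ = hasRank-resp-∼ (≗⇒∼ D≗D′)

  hasRank-unique : ∀ {D : Divisor n} {r r′} → HasRank G D r → HasRank G D r′ → r ≡ r′
  hasRank-unique (inj₁ (r≡ , _))     (inj₁ (r′≡ , _))     = trans r≡ (sym r′≡)
  hasRank-unique (inj₁ (_ , empty))  (inj₂ (_ , _ , ne , _)) = ⊥-elim (empty ne)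
  hasRank-unique (inj₂ (_ , _ , ne , _)) (inj₁ (_ , empty))  = ⊥-elim (empty ne)
  hasRank-unique (inj₂ (s , r≡s , _ , rs , maxs)) (inj₂ (s′ , r′≡s′ , _ , rs′ , maxs′)) =
    trans r≡s (trans (cong +_ (ℕP.≤-antisym (maxs′ s rs) (maxs s′ rs′))) (sym r′≡s′))

  hasRank-resp-∼-unique : ∀ {D D′ : Divisor n} {r r′} → D ∼[ G ] D′ → HasRank G D r → HasRank G D′ r′ → r ≡ r′
  hasRank-resp-∼-unique D∼D′ rD rD′ = hasRank-unique (hasRank-resp-∼ D∼D′ rD) rD′

  linSys⇒0≤deg : ∀ {D : Divisor n} → LinSysNonEmpty G D → + 0 ≤ deg D
  linSys⇒0≤deg {D} (E , effE , E∼D) =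
    ℤP.≤-trans (sumFin-nonneg effE) (ℤP.≤-reflexive (deg-resp-∼ (LinEquiv⇒∼ {G = G} {D = E} {D′ = D} E∼D)))

  hasRank-negDeg : ∀ {D : Divisor n} {r} → deg D < + 0 → HasRank G D r → r ≡ -[1+ 0 ]
  hasRank-negDeg deg<0 (inj₁ (r≡-1 , _))     = r≡-1
  hasRank-negDeg deg<0 (inj₂ (_ , _ , ne , _)) = ⊥-elim (ℤP.<⇒≱ deg<0 (linSys⇒0≤deg ne))

-- The genus and the orientation divisor

firstArgmin : ∀ {N} (f : Fin (suc N) → ℤ) →
  Σ (Fin (suc N)) λ u → (∀ v → f u ≤ f v) × (∀ v → v Fin.< u → f u < f v)
firstArgmin {zero}  f = zero , (λ { zero → ℤP.≤-refl }) , (λ { zero () })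
firstArgmin {suc N} f with firstArgmin (λ i → f (suc i))
... | u , minimal , first with f zero ℤ.≤? f (suc u)
...   | yes f0≤ = zero , (λ { zero → ℤP.≤-refl ; (suc w) → ℤP.≤-trans f0≤ (minimal w) }) , (λ { v () })
...   | no  f0≰ = suc u , (λ { zero → ℤP.<⇒≤ (ℤP.≰⇒> f0≰) ; (suc w) → minimal w })
                        , (λ { zero _ → ℤP.≰⇒> f0≰ ; (suc w) w<u → first w (ℕP.≤-pred w<u) })

module _ {n : ℕ} (G : Multigraph (suc n)) where

  lowerDegree : Fin (suc n) → ℤ
  lowerDegree u = sumFin (λ v → ⟦ does (v Fin.<? u) ⟧ + mult G u v)

  -- Every non-loop edge is counted once in the lowerDegrees, so this is |E| - |V| + 1.
  genus : ℤ
  genus = sumFin lowerDegree - + n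

  -- ν + 1 is the indegree divisor of the acyclic orientation of G by vertex index.
  ν : Divisor (suc n)
  ν u = lowerDegree u - + 1

  deg-ν : deg ν ≡ genus - + 1
  deg-ν = begin
    sumFin (λ u → lowerDegree u - + 1)              ≡⟨ sumFin-- lowerDegree (λ _ → + 1) ⟩
    sumFin lowerDegree - sumFin {suc n} (λ _ → + 1) ≡⟨ cong (_-_ (sumFin lowerDegree)) count ⟩
    sumFin lowerDegree - (+ 1 + + n)                ≡⟨ regroup (sumFin lowerDegree) (+ n) ⟩
    genus - + 1                                     ∎
    where
    open ≡-Reasoning
    count : sumFin {suc n} (λ _ → + 1) ≡ + 1 + + n
    count = trans (sumFin-const (suc n) (+ 1)) (trans (ℤP.*-identityʳ _) (ℤP.pos-+ 1 n))
    regroup : ∀ e k → e - (+ 1 + k) ≡ (e - k) - + 1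
    regroup = solve-∀

  -- At the first vertex u₀ where the potential f is minimal, every edge to an
  -- earlier vertex makes div f (u₀) drop by at least one.
  linSys-empty-below-ν : ∀ (X : Divisor (suc n)) → (∀ u → X u ≤ ν u) → ¬ LinSysNonEmpty G X
  linSys-empty-below-ν X X≤ν (F , effF , F∼X) = ℤP.<⇒≱ F<0 (effF u₀)
    where
    F∼X′ : F ∼[ G ] X
    F∼X′ = LinEquiv⇒∼ {G = G} {D = F} {D′ = X} F∼X
    f : Fin (suc n) → ℤ
    f = potential F∼X′
    u₀ : Fin (suc n)
    u₀ = proj₁ (firstArgmin f)

    earlier : ∀ m a b → - m - m * (a - b) ≡ m * (b - (a + + 1))
    earlier = solve-∀
    other : ∀ m a b → - + 0 - m * (a - b) ≡ m * (b - a)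
    other = solve-∀

    edge≤ : ∀ v (v<? : Dec (v Fin.< u₀)) → + mult G u₀ v * (f u₀ - f v) ≤ - (⟦ does v<? ⟧ + mult G u₀ v)
    edge≤ v (yes v<u₀) = ≤-by-diff (earlier (+ mult G u₀ v) (f u₀) (f v))
                           (0≤-* (0≤+ (mult G u₀ v)) (ℤP.i≤j⇒0≤j-i (<⇒+1≤ (proj₂ (proj₂ (firstArgmin f)) v v<u₀))))
    edge≤ v (no _)     = ≤-by-diff (other (+ mult G u₀ v) (f u₀) (f v))
                           (0≤-* (0≤+ (mult G u₀ v)) (ℤP.i≤j⇒0≤j-i (proj₁ (proj₂ (firstArgmin f)) v)))

    div≤ : div G f u₀ ≤ - lowerDegree u₀
    div≤ = ℤP.≤-trans (sumFin-mono-≤ (λ v → edge≤ v (v Fin.<? u₀)))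
                      (ℤP.≤-reflexive (sumFin-neg (λ v → ⟦ does (v Fin.<? u₀) ⟧ + mult G u₀ v)))

    negative : ∀ a x d l → a ≡ x + d → + 0 - (a + + 1) ≡ ((l - + 1) - x) + (- l - d)
    negative _ x d l refl = ring x d l
      where
      ring : ∀ x d l → + 0 - ((x + d) + + 1) ≡ ((l - + 1) - x) + (- l - d)
      ring = solve-∀

    F<0 : F u₀ < + 0
    F<0 = <-by-diff (negative (F u₀) (X u₀) (div G f u₀) (lowerDegree u₀) (∼-elim F∼X′ u₀))
                    (ℤP.+-mono-≤ (ℤP.i≤j⇒0≤j-i (X≤ν u₀)) (ℤP.i≤j⇒0≤j-i div≤))

sumℕ : ∀ {k} → (Fin k → ℕ) → ℕ
sumℕ {zero}  f = 0
sumℕ {suc k} f = f zero ℕ.+ sumℕ (λ i → f (suc i))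

≤-sumℕ : ∀ {k} (f : Fin k → ℕ) i → f i ℕ.≤ sumℕ f
≤-sumℕ f zero            = ℕP.m≤m+n _ _
≤-sumℕ {suc k} f (suc i) = ℕP.≤-trans (≤-sumℕ (λ j → f (suc j)) i) (ℕP.m≤n+m _ (f zero))

nonZero⇒1≤ : ∀ m → ℕ.NonZero m → + 1 ≤ + m
nonZero⇒1≤ (suc m) _ = ℤ.+≤+ (s≤s z≤n)

module _ {n : ℕ} (G : Multigraph (suc n)) where

  data Near : ℕ → Fin (suc n) → Set where
    base : ∀ {t} → Near t zero
    step : ∀ {t u v} → ℕ.NonZero (mult G v u) → Near t u → Near (suc t) v

  near? : ∀ t v → Dec (Near t v)
  near? t       zero    = yes base
  near? zero    (suc i) = no λ ()
  near? (suc t) (suc i) with FinP.any? (λ u → ℕP.nonZero? (mult G (suc i) u) ×-dec near? t u)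
  ... | yes (u , nz , near) = yes (step nz near)
  ... | no none             = no λ { (step nz near) → none (_ , nz , near) }

  near-+ : ∀ {t v} s → Near t v → Near (t ℕ.+ s) v
  near-+ s base           = base
  near-+ s (step nz near) = step nz (near-+ s near)

  reachable⇒near : ∀ {v} → Reachable G v zero → ∃ λ t → Near t v
  reachable⇒near here            = 0 , base
  reachable⇒near (step nz reach) = let t , near = reachable⇒near reach in suc t , step nz near

  NonnegOutside : Divisor (suc n) → ℕ → Set
  NonnegOutside D t = Σ (Fin (suc n) → ℤ) λ f → ∀ v → ¬ Near t v → + 0 ≤ D v + div G f v

  -- Adding K times the indicator of the vertices not Near t, with K bounding
  -- |D + div f|, repairs the vertices at distance exactly t + 1 and harms none.
  nonnegOutside-step : ∀ D t → NonnegOutside D (suc t) → NonnegOutside D t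
  nonnegOutside-step D t (f₁ , nonneg₁) = f , nonneg
    where
    D₁ : Divisor (suc n)
    D₁ v = D v + div G f₁ v
    K : ℤ
    K = sumFin (λ v → + ∣ D₁ v ∣)
    0≤K : + 0 ≤ K
    0≤K = sumFin-nonneg (λ w → 0≤+ ∣ D₁ w ∣)
    -K≤D₁ : ∀ v → - K ≤ D₁ v
    -K≤D₁ v = ℤP.≤-trans (ℤP.neg-mono-≤ (≤-sumFin (λ w → 0≤+ ∣ D₁ w ∣) v)) (-∣i∣≤i (D₁ v))

    far : Fin (suc n) → ℤ
    far v = if does (near? t v) then + 0 else + 1
    f : Fin (suc n) → ℤ
    f v = f₁ v + K * far v

    split : ∀ v → D v + div G f v ≡ D₁ v + K * div G far v
    split v = trans (cong (_+_ (D v)) (trans (div-+ G f₁ (λ w → K * far w) v) (cong (_+_ (div G f₁ v)) (div-*ˡ G K far v))))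
                    (sym (ℤP.+-assoc (D v) _ _))
    0≤1-far : ∀ x → + 0 ≤ + 1 - far x
    0≤1-far x with does (near? t x)
    ... | true  = 0≤+ 1
    ... | false = 0≤+ 0
    repaired : ∀ a k d → (a + k * d) - + 0 ≡ (a - - k) + k * (d - + 1)
    repaired = solve-∀

    nonneg : ∀ v → ¬ Near t v → + 0 ≤ D v + div G f v
    nonneg v ¬near = subst (+ 0 ≤_) (sym (split v)) (bound (near? (suc t) v))
      where
      far-v : far v ≡ + 1
      far-v with near? t v
      ... | yes near = ⊥-elim (¬near near)
      ... | no _     = refl
      edge≥0 : ∀ x → + 0 ≤ + mult G v x * (far v - far x)
      edge≥0 x rewrite far-v = 0≤-* (0≤+ (mult G v x)) (0≤1-far x)
      bound : Dec (Near (suc t) v) → + 0 ≤ D₁ v + K * div G far v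
      bound (no ¬near′) = ℤP.+-mono-≤ (nonneg₁ v ¬near′) (0≤-* 0≤K (sumFin-nonneg edge≥0))
      bound (yes near′) = neighbour near′ ¬near refl
        where
        neighbour : ∀ {w} → Near (suc t) w → ¬ Near t w → w ≡ v → + 0 ≤ D₁ v + K * div G far v
        neighbour base               ¬near-w = ⊥-elim (¬near-w base)
        neighbour (step {u = u} nz near-u) _ refl =
          ≤-by-diff (repaired (D₁ v) K (div G far v))
                    (ℤP.+-mono-≤ (ℤP.i≤j⇒0≤j-i (-K≤D₁ v)) (0≤-* 0≤K (ℤP.i≤j⇒0≤j-i 1≤div)))
          where
          far-u : far u ≡ + 0
          far-u with near? t u
          ... | yes _     = refl
          ... | no ¬nearu = ⊥-elim (¬nearu near-u)
          1≤edge : + 1 ≤ + mult G v u * (far v - far u)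
          1≤edge = subst (+ 1 ≤_) (sym (trans (cong₂ (λ a b → + mult G v u * (a - b)) far-v far-u) (ℤP.*-identityʳ _)))
                         (nonZero⇒1≤ _ nz)
          1≤div : + 1 ≤ div G far v
          1≤div = ℤP.≤-trans 1≤edge (≤-sumFin edge≥0 u)

  module _ (conn : Connected G) where

    private
      distanceBound : Fin (suc n) → ℕ
      distanceBound v = proj₁ (reachable⇒near (conn v zero))

    radius : ℕ
    radius = sumℕ distanceBound

    near-radius : ∀ v → Near radius v
    near-radius v = subst (λ t → Near t v) (ℕP.m+[n∸m]≡n (≤-sumℕ distanceBound v))
                          (near-+ (radius ℕ.∸ distanceBound v) (proj₂ (reachable⇒near (conn v zero))))

    nonnegOutside-descend : ∀ D s t → (∀ v → Near (s ℕ.+ t) v) → NonnegOutside D t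
    nonnegOutside-descend D zero    t near = (λ _ → + 0) , λ v ¬near → ⊥-elim (¬near (near v))
    nonnegOutside-descend D (suc s) t near = nonnegOutside-step D t
      (nonnegOutside-descend D s (suc t) (λ v → subst (λ r → Near r v) (sym (ℕP.+-suc s t)) (near v)))

    nonneg-away-from-0 : ∀ D → Σ (Fin (suc n) → ℤ) λ f → ∀ i → + 0 ≤ D (suc i) + div G f (suc i)
    nonneg-away-from-0 D =
      let f , nonneg = nonnegOutside-descend D radius 0
                         (λ v → subst (λ r → Near r v) (sym (ℕP.+-identityʳ radius)) (near-radius v))
      in f , λ i → nonneg (suc i) λ ()

    superharmonic : Σ (Fin (suc n) → ℤ) λ ψ → (∀ v → + 0 ≤ ψ v) × (∀ i → + 1 ≤ div G ψ (suc i))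
    superharmonic = ψ , (λ v → ℤP.i≤j⇒0≤j-i (proj₁ (proj₂ (firstArgmin ψ₀)) v)) , 1≤div
      where
      ψ₀ : Fin (suc n) → ℤ
      ψ₀ = proj₁ (nonneg-away-from-0 (λ _ → -[1+ 0 ]))
      c : ℤ
      c = ψ₀ (proj₁ (firstArgmin ψ₀))
      ψ : Fin (suc n) → ℤ
      ψ v = ψ₀ v - c
      shift : ∀ u → div G ψ u ≡ div G ψ₀ u
      shift u = trans (div-+ G ψ₀ (λ _ → - c) u) (trans (cong (_+_ (div G ψ₀ u)) (div-const G (- c) u)) (ℤP.+-identityʳ _))
      shifted : ∀ d → d - + 1 ≡ -[1+ 0 ] + d
      shifted = solve-∀
      1≤div : ∀ i → + 1 ≤ div G ψ (suc i)
      1≤div i = subst (+ 1 ≤_) (sym (shift (suc i)))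
                  (≤-by-diff (shifted (div G ψ₀ (suc i))) (proj₂ (nonneg-away-from-0 (λ _ → -[1+ 0 ])) i))

-- Firing sets

module _ {n : ℕ} (G : Multigraph (suc n)) where

  χ : Subset (suc n) → Fin (suc n) → ℤ
  χ A x = if lookup A x then + 1 else + 0

  outdeg : Subset (suc n) → Fin (suc n) → ℤ
  outdeg A v = sumFin (λ x → ⟦ not (lookup A x) ⟧ + mult G v x)

  div-χ-∈ : ∀ A v → lookup A v ≡ true → div G (χ A) v ≡ outdeg A v
  div-χ-∈ A v v∈A = sumFin-cong edge
    where
    edge : ∀ x → + mult G v x * (χ A v - χ A x) ≡ ⟦ not (lookup A x) ⟧ + mult G v x
    edge x rewrite v∈A with lookup A x
    ... | true  = ℤP.*-zeroʳ (+ mult G v x)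
    ... | false = ℤP.*-identityʳ (+ mult G v x)

  div-χ-∉ : ∀ A v → lookup A v ≡ false → div G (χ A) v ≤ + 0
  div-χ-∉ A v v∉A = ℤP.≤-trans (sumFin-mono-≤ edge) (ℤP.≤-reflexive (sumFin-zero (suc n)))
    where
    edge : ∀ x → + mult G v x * (χ A v - χ A x) ≤ + 0
    edge x rewrite v∉A with lookup A x
    ... | true  = ≤-by-diff (inward (+ mult G v x)) (0≤+ (mult G v x))
      where
      inward : ∀ m → + 0 - m * (+ 0 - + 1) ≡ m
      inward = solve-∀
    ... | false = ℤP.≤-reflexive (ℤP.*-zeroʳ (+ mult G v x))

  χ-∈ : ∀ A x → lookup A x ≡ true → χ A x ≡ + 1
  χ-∈ A x = cong (λ b → if b then + 1 else + 0)

  χ-∉ : ∀ A x → lookup A x ≡ false → χ A x ≡ + 0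
  χ-∉ A x = cong (λ b → if b then + 1 else + 0)

  0≤χ : ∀ A x → + 0 ≤ χ A x
  0≤χ A x with lookup A x
  ... | true  = 0≤+ 1
  ... | false = 0≤+ 0

  fire : Divisor (suc n) → Subset (suc n) → Divisor (suc n)
  fire D A v = D v - div G (χ A) v

  fire-∼ : ∀ D A → fire D A ∼[ G ] D
  fire-∼ D A = ∼-intro (λ x → - χ A x) (λ u → cong (_+_ (D u)) (sym (div-neg G (χ A) u)))

  fire-∉ : ∀ D A v → lookup A v ≡ false → D v ≤ fire D A v
  fire-∉ D A v v∉A = ≤-by-diff (gain (D v) (div G (χ A) v)) (ℤP.i≤j⇒0≤j-i (div-χ-∉ A v v∉A))
    where
    gain : ∀ a b → (a - b) - a ≡ + 0 - b
    gain = solve-∀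

  Legal : Divisor (suc n) → Subset (suc n) → Set
  Legal D A = lookup A zero ≡ false × (∃ λ w → lookup A w ≡ true)
            × (∀ v → lookup A v ≡ true → outdeg A v ≤ D v)

  legal? : ∀ D A → Dec (Legal D A)
  legal? D A = (lookup A zero Bool.≟ false)
         ×-dec (FinP.any? (λ w → lookup A w Bool.≟ true)
         ×-dec FinP.all? (λ v → (lookup A v Bool.≟ true) →-dec (outdeg A v ℤ.≤? D v)))

  NoLegalFiring : Divisor (suc n) → Set
  NoLegalFiring D = ∀ A → lookup A zero ≡ false → ∀ w → lookup A w ≡ true →
                    ∃ λ v → lookup A v ≡ true × D v < outdeg A v

  ¬legal⇒noLegalFiring : ∀ D → ¬ (∃ λ A → Legal D A) → NoLegalFiring D
  ¬legal⇒noLegalFiring D ¬legal A 0∉A w w∈A with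
    FinP.¬∀⟶∃¬ (suc n) _ (λ v → (lookup A v Bool.≟ true) →-dec (outdeg A v ℤ.≤? D v))
               (λ pays → ¬legal (A , 0∉A , (w , w∈A) , pays))
  ... | v , ¬pays with lookup A v Bool.≟ true
  ...   | yes v∈A = v , v∈A , ℤP.≰⇒> (λ pays → ¬pays (λ _ → pays))
  ...   | no  v∉A = ⊥-elim (¬pays (λ v∈A → ⊥-elim (v∉A v∈A)))

  module _ (conn : Connected G) where

    private
      ψ : Fin (suc n) → ℤ
      ψ = proj₁ (superharmonic G conn)
      0≤ψ : ∀ v → + 0 ≤ ψ v
      0≤ψ = proj₁ (proj₂ (superharmonic G conn))
      1≤div-ψ : ∀ i → + 1 ≤ div G ψ (suc i)
      1≤div-ψ = proj₂ (proj₂ (superharmonic G conn))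

    energy : Divisor (suc n) → ℤ
    energy D = sumFin (λ v → ψ v * D v)

    energy-fire : ∀ D A → Legal D A → energy (fire D A) + + 1 ≤ energy D
    energy-fire D A (0∉A , (w , w∈A) , _) =
      ≤-by-diff (trans (cong (λ e → energy D - (e + + 1)) expand) (drop (energy D) flow)) (ℤP.i≤j⇒0≤j-i 1≤flow)
      where
      flow : ℤ
      flow = sumFin (λ v → χ A v * div G ψ v)
      distrib : ∀ p d c → p * (d - c) ≡ p * d - p * c
      distrib = solve-∀
      drop : ∀ e f → e - ((e - f) + + 1) ≡ f - + 1
      drop = solve-∀
      expand : energy (fire D A) ≡ energy D - flow
      expand = trans (sumFin-cong (λ v → distrib (ψ v) (D v) (div G (χ A) v)))
                     (trans (sumFin-- (λ v → ψ v * D v) (λ v → ψ v * div G (χ A) v))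
                            (cong (_-_ (energy D)) (div-selfAdjoint G ψ (χ A))))
      0≤term : ∀ v → + 0 ≤ χ A v * div G ψ v
      0≤term zero    = ℤP.≤-reflexive (sym (trans (cong (_* div G ψ zero) (χ-∉ A zero 0∉A)) (ℤP.*-zeroˡ (div G ψ zero))))
      0≤term (suc i) = 0≤-* (0≤χ A (suc i)) (ℤP.≤-trans (0≤+ 1) (1≤div-ψ i))
      1≤term : ∀ v → lookup A v ≡ true → + 1 ≤ χ A v * div G ψ v
      1≤term zero    v∈A = contradiction (trans (sym v∈A) 0∉A) λ ()
      1≤term (suc i) v∈A = subst (+ 1 ≤_) (sym (trans (cong (_* div G ψ (suc i)) (χ-∈ A (suc i) v∈A)) (ℤP.*-identityˡ _)))
                                 (1≤div-ψ i)
      1≤flow : + 1 ≤ flow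
      1≤flow = ℤP.≤-trans (1≤term w w∈A) (≤-sumFin 0≤term w)

    Admissible : Divisor (suc n) → Divisor (suc n) → Set
    Admissible D₀ D = D ∼[ G ] D₀ × (∀ i → + 0 ≤ D (suc i)) × (D₀ zero ≤ D zero)

    fire-admissible : ∀ {D₀ D A} → Admissible D₀ D → Legal D A → Admissible D₀ (fire D A)
    fire-admissible {D₀} {D} {A} (D∼D₀ , 0≤D , D₀≤D) (0∉A , _ , pays) =
      ∼-trans (fire-∼ D A) D∼D₀ , 0≤fire , ℤP.≤-trans D₀≤D (fire-∉ D A zero 0∉A)
      where
      0≤fire : ∀ i → + 0 ≤ fire D A (suc i)
      0≤fire i = byMembership (lookup A (suc i)) refl
        where
        byMembership : ∀ b → lookup A (suc i) ≡ b → + 0 ≤ fire D A (suc i)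
        byMembership true  i∈A = subst (λ d → + 0 ≤ D (suc i) - d) (sym (div-χ-∈ A (suc i) i∈A))
                                       (ℤP.i≤j⇒0≤j-i (pays (suc i) i∈A))
        byMembership false i∉A = ℤP.≤-trans (0≤D i) (fire-∉ D A (suc i) i∉A)

    -- ψ ≥ 0 turns the admissibility constraints into a lower bound on the energy.
    energy-admissible : ∀ {D₀ D} → Admissible D₀ D → ψ zero * D₀ zero ≤ energy D
    energy-admissible {D₀} {D} (_ , 0≤D , D₀≤D) =
      ≤-by-diff (regroup (ψ zero) (D zero) (D₀ zero) (sumFin (λ i → ψ (suc i) * D (suc i))))
                (ℤP.+-mono-≤ (0≤-* (0≤ψ zero) (ℤP.i≤j⇒0≤j-i D₀≤D))
                             (sumFin-nonneg (λ i → 0≤-* (0≤ψ (suc i)) (0≤D i))))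
      where
      regroup : ∀ p d d₀ s → (p * d + s) - p * d₀ ≡ p * (d - d₀) + s
      regroup = solve-∀

    excess : Divisor (suc n) → Divisor (suc n) → ℤ
    excess D₀ D = energy D - ψ zero * D₀ zero

    excess-fire : ∀ {D₀ D A} → Legal D A → excess D₀ (fire D A) + + 1 ≤ excess D₀ D
    excess-fire {D₀} {D} {A} legal =
      ≤-by-diff (regroup (energy D) (energy (fire D A)) (ψ zero * D₀ zero)) (ℤP.i≤j⇒0≤j-i (energy-fire D A legal))
      where
      regroup : ∀ e e′ b → (e - b) - ((e′ - b) + + 1) ≡ e - (e′ + + 1)
      regroup = solve-∀

    0≤excess : ∀ {D₀ D} → Admissible D₀ D → + 0 ≤ excess D₀ D
    0≤excess {D₀} adm = ℤP.i≤j⇒0≤j-i (energy-admissible {D₀ = D₀} adm)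

    excess-positive : ∀ {D₀ D A} → Admissible D₀ D → Legal D A → ¬ (excess D₀ D ≤ + 0)
    excess-positive {D₀} {D} {A} adm legal = ℤP.<⇒≱ 0<excess
      where
      regroup : ∀ x x′ → x - (+ 0 + + 1) ≡ (x - (x′ + + 1)) + x′
      regroup = solve-∀
      0<excess : + 0 < excess D₀ D
      0<excess = <-by-diff (regroup (excess D₀ D) (excess D₀ (fire D A)))
                   (ℤP.+-mono-≤ (ℤP.i≤j⇒0≤j-i (excess-fire {D₀ = D₀} {A = A} legal))
                                (0≤excess (fire-admissible {A = A} adm legal)))

    excess-decreases : ∀ {D₀ D A fuel} → Legal D A → excess D₀ D ≤ + suc fuel → excess D₀ (fire D A) ≤ + fuel
    excess-decreases {D₀} {D} {A} {fuel} legal bounded =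
      ≤-by-diff (regroup (+ fuel) (excess D₀ D) (excess D₀ (fire D A)))
                (ℤP.+-mono-≤ (ℤP.i≤j⇒0≤j-i bounded) (ℤP.i≤j⇒0≤j-i (excess-fire {D₀ = D₀} {A = A} legal)))
      where
      regroup : ∀ f x x′ → f - x′ ≡ ((+ 1 + f) - x) + (x - (x′ + + 1))
      regroup = solve-∀

    reduce : ∀ {D₀} fuel D → Admissible D₀ D → excess D₀ D ≤ + fuel →
             Σ (Divisor (suc n)) λ D′ → Admissible D₀ D′ × NoLegalFiring D′
    reduce fuel D adm bounded with anySubset? (legal? D)
    reduce fuel       D adm bounded | no ¬legal = D , adm , ¬legal⇒noLegalFiring D ¬legal
    reduce zero       D adm bounded | yes (A , legal) = ⊥-elim (excess-positive {A = A} adm legal bounded)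
    reduce {D₀} (suc fuel) D adm bounded | yes (A , legal) =
      reduce fuel (fire D A) (fire-admissible {A = A} adm legal) (excess-decreases {D₀ = D₀} {A = A} legal bounded)
-- Dhar's burning bound

module _ {n : ℕ} (G : Multigraph (suc n)) where

  weight : Divisor (suc n) → Subset (suc n) → ℤ
  weight D A = sumFin (λ v → ⟦ lookup A v ⟧ D v)

  size : Subset (suc n) → ℤ
  size = weight (λ _ → + 1)

  edgesTouching : Subset (suc n) → ℤ
  edgesTouching A =
    sumFin (λ u → sumFin (λ x → ⟦ does (x Fin.<? u) ⟧ ⟦ lookup A u ∨ lookup A x ⟧ + mult G u x))

  0≤edgesTouching : ∀ A → + 0 ≤ edgesTouching A
  0≤edgesTouching A = sumFin-nonneg λ u → sumFin-nonneg λ x →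
    0≤⟦⟧ (does (x Fin.<? u)) (0≤⟦⟧ (lookup A u ∨ lookup A x) (0≤+ (mult G u x)))

  module Removal (A : Subset (suc n)) (v : Fin (suc n)) (v∈A : lookup A v ≡ true) where

    A′ : Subset (suc n)
    A′ = A [ v ]≔ false

    v∉A′ : lookup A′ v ≡ false
    v∉A′ = VecP.lookup∘update v A false

    A′-other : ∀ x → x ≢ v → lookup A′ x ≡ lookup A x
    A′-other x x≢v = VecP.lookup∘update′ x≢v A false

    weight-remove : ∀ D → weight D A ≡ weight D A′ + D v
    weight-remove D =
      trans (sumFin-cong split) (trans (sumFin-+ (λ x → ⟦ lookup A′ x ⟧ D x) (λ x → ⟦ does (x Fin.≟ v) ⟧ D x))
                                       (cong (_+_ (weight D A′)) (sumFin-select v D)))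
      where
      split : ∀ x → ⟦ lookup A x ⟧ D x ≡ ⟦ lookup A′ x ⟧ D x + ⟦ does (x Fin.≟ v) ⟧ D x
      split x with x Fin.≟ v
      ... | yes refl rewrite v∈A | v∉A′ = sym (ℤP.+-identityˡ (D x))
      ... | no x≢v   rewrite A′-other x x≢v = sym (ℤP.+-identityʳ _)

    private
      from-v : ∀ l b (m : ℤ) → ⟦ l ⟧ m ≡ ⟦ l ⟧ ⟦ b ⟧ m + ⟦ l ⟧ ⟦ not b ⟧ m + + 0
      from-v true  true  m = sym (trans (ℤP.+-identityʳ _) (ℤP.+-identityʳ m))
      from-v true  false m = sym (trans (ℤP.+-identityʳ _) (ℤP.+-identityˡ m))
      from-v false b     m = refl

      to-v : ∀ l a (m : ℤ) → ⟦ l ⟧ ⟦ a ∨ true ⟧ m ≡ ⟦ l ⟧ ⟦ a ∨ false ⟧ m + + 0 + ⟦ l ⟧ ⟦ not a ⟧ m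
      to-v true  true  m = sym (trans (ℤP.+-identityʳ _) (ℤP.+-identityʳ m))
      to-v true  false m = sym (ℤP.+-identityˡ m)
      to-v false a     m = refl

      loop : ∀ l → l ≡ false → ∀ x y z w → ⟦ l ⟧ x ≡ ⟦ l ⟧ y + ⟦ l ⟧ z + ⟦ l ⟧ w
      loop false refl x y z w = refl

    -- An edge loses its contact with A exactly when it joins v to the outside of A.
    touching-remove : ∀ u x →
      ⟦ does (x Fin.<? u) ⟧ ⟦ lookup A u ∨ lookup A x ⟧ + mult G u x
      ≡ ⟦ does (x Fin.<? u) ⟧ ⟦ lookup A′ u ∨ lookup A′ x ⟧ + mult G u x
        + ⟦ does (u Fin.≟ v) ⟧ ⟦ does (x Fin.<? u) ⟧ ⟦ not (lookup A x) ⟧ + mult G u x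
        + ⟦ does (x Fin.≟ v) ⟧ ⟦ does (x Fin.<? u) ⟧ ⟦ not (lookup A u) ⟧ + mult G u x
    touching-remove u x with u Fin.≟ v | x Fin.≟ v
    ... | yes refl | yes refl = loop (does (u Fin.<? u)) (dec-false (u Fin.<? u) (FinP.<-irrefl refl)) _ _ _ _
    ... | yes refl | no x≢v rewrite v∈A | v∉A′ | A′-other x x≢v = from-v (does (x Fin.<? u)) (lookup A x) _
    ... | no u≢v | yes refl rewrite v∈A | v∉A′ | A′-other u u≢v = to-v (does (x Fin.<? u)) (lookup A u) _
    ... | no u≢v | no x≢v rewrite A′-other u u≢v | A′-other x x≢v = sym (trans (ℤP.+-identityʳ _) (ℤP.+-identityʳ _))

    outdeg-split : ∀ x → ⟦ not (lookup A x) ⟧ + mult G v x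
      ≡ ⟦ does (x Fin.<? v) ⟧ ⟦ not (lookup A x) ⟧ + mult G v x + ⟦ does (v Fin.<? x) ⟧ ⟦ not (lookup A x) ⟧ + mult G x v
    outdeg-split x with FinP.<-cmp x v
    ... | tri< x<v _ v≮x rewrite dec-true (x Fin.<? v) x<v | dec-false (v Fin.<? x) v≮x = sym (ℤP.+-identityʳ _)
    ... | tri> x≮v _ v<x rewrite dec-false (x Fin.<? v) x≮v | dec-true (v Fin.<? x) v<x | mult-sym G x v = sym (ℤP.+-identityˡ _)
    ... | tri≈ x≮x refl _ rewrite v∈A | dec-false (x Fin.<? x) x≮x = refl

    edgesTouching-remove : edgesTouching A ≡ edgesTouching A′ + outdeg G A v
    edgesTouching-remove = begin
      edgesTouching A
        ≡⟨ sumFin-cong (λ u → trans (sumFin-cong (touching-remove u)) (split3 (T₁ u) (T₂ u) (T₃ u))) ⟩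
      sumFin (λ u → sumFin (T₁ u) + sumFin (T₂ u) + sumFin (T₃ u))
        ≡⟨ split3 (λ u → sumFin (T₁ u)) (λ u → sumFin (T₂ u)) (λ u → sumFin (T₃ u)) ⟩
      edgesTouching A′ + sumFin (λ u → sumFin (T₂ u)) + sumFin (λ u → sumFin (T₃ u))
        ≡⟨ cong₂ (λ a b → edgesTouching A′ + a + b) fromV toV ⟩
      edgesTouching A′ + sumFin (λ x → ⟦ does (x Fin.<? v) ⟧ ⟦ not (lookup A x) ⟧ + mult G v x)
                       + sumFin (λ x → ⟦ does (v Fin.<? x) ⟧ ⟦ not (lookup A x) ⟧ + mult G x v)
        ≡⟨ ℤP.+-assoc (edgesTouching A′) _ _ ⟩
      edgesTouching A′ + (sumFin (λ x → ⟦ does (x Fin.<? v) ⟧ ⟦ not (lookup A x) ⟧ + mult G v x)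
                          + sumFin (λ x → ⟦ does (v Fin.<? x) ⟧ ⟦ not (lookup A x) ⟧ + mult G x v))
        ≡⟨ cong (_+_ (edgesTouching A′)) (trans (sym (sumFin-+ (λ x → ⟦ does (x Fin.<? v) ⟧ ⟦ not (lookup A x) ⟧ + mult G v x)
                                                                  (λ x → ⟦ does (v Fin.<? x) ⟧ ⟦ not (lookup A x) ⟧ + mult G x v)))
                                                  (sym (sumFin-cong outdeg-split))) ⟩
      edgesTouching A′ + outdeg G A v ∎
      where
      open ≡-Reasoning
      T₁ T₂ T₃ : Fin (suc n) → Fin (suc n) → ℤ
      T₁ u x = ⟦ does (x Fin.<? u) ⟧ ⟦ lookup A′ u ∨ lookup A′ x ⟧ + mult G u x
      T₂ u x = ⟦ does (u Fin.≟ v) ⟧ ⟦ does (x Fin.<? u) ⟧ ⟦ not (lookup A x) ⟧ + mult G u x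
      T₃ u x = ⟦ does (x Fin.≟ v) ⟧ ⟦ does (x Fin.<? u) ⟧ ⟦ not (lookup A u) ⟧ + mult G u x
      split3 : ∀ (f g h : Fin (suc n) → ℤ) → sumFin (λ x → f x + g x + h x) ≡ sumFin f + sumFin g + sumFin h
      split3 f g h = trans (sumFin-+ (λ x → f x + g x) h) (cong (_+ sumFin h) (sumFin-+ f g))
      fromV : sumFin (λ u → sumFin (T₂ u)) ≡ sumFin (λ x → ⟦ does (x Fin.<? v) ⟧ ⟦ not (lookup A x) ⟧ + mult G v x)
      fromV = trans (sumFin-cong (λ u → sumFin-⟦⟧ (does (u Fin.≟ v))
                                                  (λ x → ⟦ does (x Fin.<? u) ⟧ ⟦ not (lookup A x) ⟧ + mult G u x)))
                    (sumFin-select v (λ u → sumFin (λ x → ⟦ does (x Fin.<? u) ⟧ ⟦ not (lookup A x) ⟧ + mult G u x)))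
      toV : sumFin (λ u → sumFin (T₃ u)) ≡ sumFin (λ x → ⟦ does (v Fin.<? x) ⟧ ⟦ not (lookup A x) ⟧ + mult G x v)
      toV = sumFin-cong (λ u → sumFin-select v (λ x → ⟦ does (x Fin.<? u) ⟧ ⟦ not (lookup A u) ⟧ + mult G u x))

  -- Dhar's burning argument: peel off, one at a time, vertices v of A with D v < outdeg A v.
  burning-bound : ∀ {D} → NoLegalFiring G D → ∀ fuel A → lookup A zero ≡ false → size A ≤ + fuel →
                  weight D A + size A ≤ edgesTouching A
  burning-bound {D} noFiring fuel A 0∉A small with FinP.any? (λ w → lookup A w Bool.≟ true)
  ... | no empty = subst (_≤ edgesTouching A) (sym (cong₂ _+_ (vanish D) (vanish (λ _ → + 1)))) (0≤edgesTouching A)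
    where
    vanish : ∀ F → weight F A ≡ + 0
    vanish F = trans (sumFin-cong (λ x → cong (λ b → ⟦ b ⟧ F x) (BoolP.¬-not (λ x∈A → empty (x , x∈A)))))
                     (sumFin-zero (suc n))
  ... | yes (w , w∈A) with noFiring A 0∉A w w∈A
  ...   | v , v∈A , Dv<out = peel fuel small
    where
    open Removal A v v∈A
    size-remove : size A ≡ size A′ + + 1
    size-remove = weight-remove (λ _ → + 1)
    0∉A′ : lookup A′ zero ≡ false
    0∉A′ with zero Fin.≟ v
    ... | yes refl = v∉A′
    ... | no 0≢v   = trans (A′-other zero 0≢v) 0∉A
    peel : ∀ fuel → size A ≤ + fuel → weight D A + size A ≤ edgesTouching A
    peel zero    small = ⊥-elim (ℤP.<⇒≱ 0<size small)
      where
      0<size : + 0 < size A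
      0<size = subst (+ 0 <_) (sym size-remove)
                     (ℤP.+-mono-≤-< (sumFin-nonneg (λ x → 0≤⟦⟧ (lookup A′ x) (0≤+ 1))) (ℤ.+<+ (s≤s z≤n)))
    peel (suc fuel) small = subst₂ _≤_ (sym (cong₂ _+_ (weight-remove D) size-remove)) (sym edgesTouching-remove) peeled
      where
      shrink : ∀ s′ f → f - s′ ≡ (+ 1 + f) - (s′ + + 1)
      shrink = solve-∀
      small′ : size A′ ≤ + fuel
      small′ = ≤-by-diff (shrink (size A′) (+ fuel)) (ℤP.i≤j⇒0≤j-i (subst (_≤ + suc fuel) size-remove small))
      regroup : ∀ w d s e o → (e + o) - ((w + d) + (s + + 1)) ≡ (e - (w + s)) + (o - (d + + 1))
      regroup = solve-∀
      peeled : (weight D A′ + D v) + (size A′ + + 1) ≤ edgesTouching A′ + outdeg G A v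
      peeled = ≤-by-diff (regroup (weight D A′) (D v) (size A′) (edgesTouching A′) (outdeg G A v))
               (ℤP.+-mono-≤ (ℤP.i≤j⇒0≤j-i (burning-bound noFiring fuel A′ 0∉A′ small′))
                            (ℤP.i≤j⇒0≤j-i (<⇒+1≤ Dv<out)))

  offBase : Subset (suc n)
  offBase = false ∷ Vec.replicate n true

  noLegalFiring⇒offBase≤genus : ∀ {D} → NoLegalFiring G D → sumFin (λ i → D (suc i)) ≤ genus G
  noLegalFiring⇒offBase≤genus {D} noFiring =
    ≤-by-diff (regroup (sumFin (λ i → D (suc i))) (+ n) (sumFin (lowerDegree G)))
              (ℤP.i≤j⇒0≤j-i (subst₂ _≤_ (cong₂ _+_ weight-offBase size-offBase) edges-offBase
                              (burning-bound noFiring n offBase refl (ℤP.≤-reflexive size-offBase))))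
    where
    regroup : ∀ s k e → (e - k) - s ≡ e - (s + k)
    regroup = solve-∀
    inside : ∀ i → lookup offBase (suc i) ≡ true
    inside i = VecP.lookup-replicate i true
    weight-offBase : weight D offBase ≡ sumFin (λ i → D (suc i))
    weight-offBase = trans (ℤP.+-identityˡ _) (sumFin-cong (λ i → cong (λ b → ⟦ b ⟧ D (suc i)) (inside i)))
    size-offBase : size offBase ≡ + n
    size-offBase = trans (ℤP.+-identityˡ _) (trans (sumFin-cong {g = λ _ → + 1} (λ i → cong (λ b → ⟦ b ⟧ + 1) (inside i)))
                                                   (trans (sumFin-const n (+ 1)) (ℤP.*-identityʳ _)))
    edges-offBase : edgesTouching offBase ≡ sumFin (lowerDegree G)
    edges-offBase = sumFin-cong (λ u → sumFin-cong (edge u))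
      where
      edge : ∀ u x → ⟦ does (x Fin.<? u) ⟧ ⟦ lookup offBase u ∨ lookup offBase x ⟧ + mult G u x
                   ≡ ⟦ does (x Fin.<? u) ⟧ + mult G u x
      edge zero    x = refl
      edge (suc j) x rewrite inside j = refl

module _ {n : ℕ} (G : Multigraph (suc n)) (conn : Connected G) where

  -- Opaque: only existence matters, and unfolding the reduction is very costly.
  opaque
    linSys-nonempty : ∀ D → genus G ≤ deg D → LinSysNonEmpty G D
    linSys-nonempty D genus≤deg = D₂ , effective , ∼⇒LinEquiv (∼-trans D₂∼D₁ D₁∼D)
      where
      f : Fin (suc n) → ℤ
      f = proj₁ (nonneg-away-from-0 G conn D)
      D₁ : Divisor (suc n)
      D₁ v = D v + div G f v
      D₁∼D : D₁ ∼[ G ] D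
      D₁∼D = ∼-intro f (λ _ → refl)
      adm₁ : Admissible G conn D₁ D₁
      adm₁ = ≗⇒∼ (λ _ → refl) , proj₂ (nonneg-away-from-0 G conn D) , ℤP.≤-refl
      reduced : Σ (Divisor (suc n)) λ D′ → Admissible G conn D₁ D′ × NoLegalFiring G D′
      reduced = reduce G conn ∣ excess G conn D₁ D₁ ∣ D₁ adm₁ (i≤∣i∣ _)
      D₂ : Divisor (suc n)
      D₂ = proj₁ reduced
      D₂∼D₁ : D₂ ∼[ G ] D₁
      D₂∼D₁ = proj₁ (proj₁ (proj₂ reduced))
      regroup : ∀ a s → a - + 0 ≡ (a + s) - s
      regroup = solve-∀
      effective : Effective D₂
      effective zero    = ≤-by-diff (regroup (D₂ zero) (sumFin (λ i → D₂ (suc i))))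
        (ℤP.i≤j⇒0≤j-i (ℤP.≤-trans (noLegalFiring⇒offBase≤genus G (proj₂ (proj₂ reduced)))
                                 (ℤP.≤-trans genus≤deg (ℤP.≤-reflexive (deg-resp-∼ (∼-sym (∼-trans D₂∼D₁ D₁∼D)))))))
      effective (suc i) = proj₁ (proj₂ (proj₁ (proj₂ reduced))) i

-- Large degree, and torsion of the Jacobian

funToFin-injective : ∀ {m k} (f g : Fin m → Fin k) → Fin.funToFin f ≡ Fin.funToFin g → ∀ u → f u ≡ g u
funToFin-injective f g eq u =
  trans (sym (FinP.finToFun-funToFin f u)) (trans (cong (λ c → Fin.finToFun c u) eq) (FinP.finToFun-funToFin g u))

pigeonhole-ℕ : ∀ {K} (c : ℕ → Fin K) → ∃ λ i → ∃ λ j → i ℕ.< j × c i ≡ c j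
pigeonhole-ℕ {K} c with FinP.pigeonhole (ℕP.n<1+n K) (c ∘ toℕ)
... | i , j , i<j , same = toℕ i , toℕ j , i<j , same

module _ {n : ℕ} (G : Multigraph (suc n)) (conn : Connected G) where

  chips : ℕ → Divisor (suc n)
  chips c zero    = + c
  chips c (suc _) = + 0

  deg-chips : ∀ c → deg (chips c) ≡ + c
  deg-chips c = trans (cong (_+_ (+ c)) (sumFin-zero n)) (ℤP.+-identityʳ _)

  deg-+ : ∀ (D E : Divisor (suc n)) → deg (λ u → D u + E u) ≡ deg D + deg E
  deg-+ = sumFin-+

  deg-∸ : ∀ (D E : Divisor (suc n)) → deg (D -D E) ≡ deg D - deg E
  deg-∸ = sumFin--

  rankAtLeast-of-deg : ∀ D s → + s ≤ deg D - genus G → RankAtLeast G D s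
  rankAtLeast-of-deg D s s≤ E _ degE = linSys-nonempty G conn (D -D E)
    (≤-by-diff (trans (cong (λ d → d - genus G) (trans (deg-∸ D E) (cong (_-_ (deg D)) degE)))
                      (regroup (deg D) (+ s) (genus G)))
               (ℤP.i≤j⇒0≤j-i s≤))
    where
    regroup : ∀ d s g → (d - s) - g ≡ (d - g) - s
    regroup = solve-∀

  -- If |D - E| ≠ ∅ for every effective E of degree t, choose E ∼ D - ν plus
  -- extra chips at 0: then ν - (chips) would have a nonempty linear system.
  rankAtLeast⇒≤ : ∀ D t → genus G ≤ deg D - genus G + + 1 → RankAtLeast G D t → + t ≤ deg D - genus G
  rankAtLeast⇒≤ D t large atLeast with + t ℤ.≤? deg D - genus G
  ... | yes t≤ = t≤
  ... | no  t≰ = ⊥-elim (linSys-empty-below-ν G (ν G -D chips c) below (linSys-resp-∼ {G = G} D-E∼ν-c (atLeast E effE degE)))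
    where
    g : ℤ
    g = genus G
    X : Divisor (suc n)
    X = D -D ν G
    degX : deg X ≡ deg D - g + + 1
    degX = trans (deg-∸ D (ν G)) (trans (cong (_-_ (deg D)) (deg-ν G)) (regroup (deg D) g))
      where
      regroup : ∀ d g → d - (g - + 1) ≡ d - g + + 1
      regroup = solve-∀
    E₀-exists : LinSysNonEmpty G X
    E₀-exists = linSys-nonempty G conn X (subst (g ≤_) (sym degX) large)
    E₀ : Divisor (suc n)
    E₀ = proj₁ E₀-exists
    E₀∼X : E₀ ∼[ G ] X
    E₀∼X = LinEquiv⇒∼ {G = G} {D = E₀} {D′ = X} (proj₂ (proj₂ E₀-exists))
    surplus : ℤ
    surplus = + t - (deg D - g + + 1)
    0≤surplus : + 0 ≤ surplus
    0≤surplus = ℤP.i≤j⇒0≤j-i (<⇒+1≤ (ℤP.≰⇒> t≰))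
    c : ℕ
    c = ∣ surplus ∣
    E : Divisor (suc n)
    E u = E₀ u + chips c u
    0≤chips : ∀ u → + 0 ≤ chips c u
    0≤chips zero    = 0≤+ c
    0≤chips (suc _) = ℤP.≤-refl
    effE : Effective E
    effE u = ℤP.+-mono-≤ (proj₁ (proj₂ E₀-exists) u) (0≤chips u)
    total : ∀ x y → x + (y - x) ≡ y
    total = solve-∀
    degE : deg E ≡ + t
    degE = trans (deg-+ E₀ (chips c))
                 (trans (cong₂ _+_ (trans (deg-resp-∼ E₀∼X) degX) (trans (deg-chips c) (ℤP.0≤i⇒+∣i∣≡i 0≤surplus)))
                        (total (deg D - g + + 1) (+ t)))
    D-E∼ν-c : (D -D E) ∼[ G ] (ν G -D chips c)
    D-E∼ν-c = ∼-from-difference (λ u → regroup (D u) (E₀ u) (chips c u) (ν G u)) (∼-sym E₀∼X)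
      where
      regroup : ∀ d e₀ k ν → (d - (e₀ + k)) - (ν - k) ≡ (d - ν) - e₀
      regroup = solve-∀
    below : ∀ u → ν G u - chips c u ≤ ν G u
    below u = ≤-by-diff (drop (ν G u) (chips c u)) (0≤chips u)
      where
      drop : ∀ a b → a - (a - b) ≡ b
      drop = solve-∀

  -- Any threshold ≥ 2g - 1 works; this one also makes deg D - g nonnegative.
  largeDegree : ℤ
  largeDegree = genus G + + ∣ genus G ∣ + + 1

  hasRank-largeDegree : ∀ D {r} → largeDegree ≤ deg D → HasRank G D r → r ≡ deg D - genus G
  hasRank-largeDegree D large (inj₁ (_ , empty)) = ⊥-elim (empty (linSys-nonempty G conn D g≤deg))
    where
    g≤deg : genus G ≤ deg D
    g≤deg = ℤP.≤-trans (≤-by-diff (slack (genus G) (+ ∣ genus G ∣)) (0≤+ (suc ∣ genus G ∣))) large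
      where
      slack : ∀ g a → (g + a + + 1) - g ≡ + 1 + a
      slack = solve-∀
  hasRank-largeDegree D large (inj₂ (s , r≡s , _ , atLeast , maximal)) =
    trans r≡s (ℤP.≤-antisym (rankAtLeast⇒≤ D s large′ atLeast)
                            (subst (_≤ + s) ∣d-g∣≡ (ℤ.+≤+ (maximal ∣ d - g ∣ atLeast₀))))
    where
    d g : ℤ
    d = deg D
    g = genus G
    regroup : ∀ d g a → d - g - + 0 ≡ a + (d - (g + a + + 1)) + + 1
    regroup = solve-∀
    0≤d-g : + 0 ≤ d - g
    0≤d-g = ≤-by-diff (regroup d g (+ ∣ g ∣))
                      (ℤP.+-mono-≤ (ℤP.+-mono-≤ (0≤+ ∣ g ∣) (ℤP.i≤j⇒0≤j-i large)) (0≤+ 1))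
    ∣d-g∣≡ : + ∣ d - g ∣ ≡ d - g
    ∣d-g∣≡ = ℤP.0≤i⇒+∣i∣≡i 0≤d-g
    atLeast₀ : RankAtLeast G D ∣ d - g ∣
    atLeast₀ = rankAtLeast-of-deg D ∣ d - g ∣ (ℤP.≤-reflexive ∣d-g∣≡)
    regroup′ : ∀ d g a → (d - g + + 1) - g ≡ (a - g) + (d - (g + a + + 1)) + + 2
    regroup′ = solve-∀
    large′ : g ≤ d - g + + 1
    large′ = ≤-by-diff (regroup′ d g (+ ∣ g ∣))
               (ℤP.+-mono-≤ (ℤP.+-mono-≤ (ℤP.i≤j⇒0≤j-i (i≤∣i∣ g)) (ℤP.i≤j⇒0≤j-i large)) (0≤+ 2))

  -- Effective divisors of degree a = |g| have all entries in [0, a]. Each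
  -- chips a + j Z has degree a ≥ g, hence is equivalent to such a divisor, and by
  -- pigeonhole two of them, for j = i < j′, are equivalent to the same one.
  module Torsion (Z : Divisor (suc n)) (degZ : deg Z ≡ + 0) where

    a : ℕ
    a = ∣ genus G ∣

    B : ℕ → Divisor (suc n)
    B j u = chips a u + + j * Z u

    degB : ∀ j → deg (B j) ≡ + a
    degB j = trans (deg-+ (chips a) (λ u → + j * Z u))
                   (trans (cong₂ _+_ (deg-chips a) (trans (sumFin-*ˡ (+ j) Z) (trans (cong (+ j *_) degZ) (ℤP.*-zeroʳ (+ j)))))
                          (ℤP.+-identityʳ _))

    effective : ∀ j → LinSysNonEmpty G (B j)
    effective j = linSys-nonempty G conn (B j) (ℤP.≤-trans (i≤∣i∣ (genus G)) (ℤP.≤-reflexive (sym (degB j))))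

    E : ℕ → Divisor (suc n)
    E j = proj₁ (effective j)

    effE : ∀ j → Effective (E j)
    effE j = proj₁ (proj₂ (effective j))

    E∼B : ∀ j → E j ∼[ G ] B j
    E∼B j = LinEquiv⇒∼ {G = G} {D = E j} {D′ = B j} (proj₂ (proj₂ (effective j)))

    entry< : ∀ j u → ∣ E j u ∣ ℕ.< suc a
    entry< j u = s≤s (ℤP.drop‿+≤+ (ℤP.≤-trans (ℤP.≤-reflexive (ℤP.0≤i⇒+∣i∣≡i (effE j u)))
                     (ℤP.≤-trans (≤-sumFin (effE j) u) (ℤP.≤-reflexive (trans (deg-resp-∼ (E∼B j)) (degB j))))))

    entries : ℕ → Fin (suc n) → Fin (suc a)
    entries j u = Fin.fromℕ< (entry< j u)

    code : ℕ → Fin (suc a ℕ.^ suc n)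
    code j = Fin.funToFin (entries j)

    sameCode⇒∼ : ∀ {i j} → code i ≡ code j → B i ∼[ G ] B j
    sameCode⇒∼ {i} {j} same = ∼-trans (∼-sym (E∼B i)) (∼-trans (≗⇒∼ sameEntries) (E∼B j))
      where
      sameEntries : ∀ u → E i u ≡ E j u
      sameEntries u = begin
        E i u                        ≡⟨ ℤP.0≤i⇒+∣i∣≡i (effE i u) ⟨
        + ∣ E i u ∣                  ≡⟨ cong +_ (FinP.toℕ-fromℕ< (entry< i u)) ⟨
        + toℕ (entries i u)          ≡⟨ cong (λ c → + toℕ c) (funToFin-injective (entries i) (entries j) same u) ⟩
        + toℕ (entries j u)          ≡⟨ cong +_ (FinP.toℕ-fromℕ< (entry< j u)) ⟩
        + ∣ E j u ∣                  ≡⟨ ℤP.0≤i⇒+∣i∣≡i (effE j u) ⟩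
        E j u                        ∎
        where open ≡-Reasoning

    B-difference : ∀ i N u → + suc N * Z u - + 0 ≡ B (i ℕ.+ suc N) u - B i u
    B-difference i N u = trans (shift (chips a u) (Z u) (+ i) (+ suc N))
                               (cong (λ m → (chips a u + m * Z u) - B i u) (sym (ℤP.pos-+ i (suc N))))
      where
      shift : ∀ x z i m → m * z - + 0 ≡ (x + (i + m) * z) - (x + i * z)
      shift = solve-∀

  -- Opaque for the same reason as linSys-nonempty.
  opaque
    torsion : ∀ Z → deg Z ≡ + 0 → Σ ℕ λ N → (λ u → + suc N * Z u) ∼[ G ] (λ _ → + 0)
    torsion Z degZ = fromCollision (pigeonhole-ℕ code)
      where
      open Torsion Z degZ
      fromCollision : (∃ λ i → ∃ λ j → i ℕ.< j × code i ≡ code j) →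
                      Σ ℕ λ N → (λ u → + suc N * Z u) ∼[ G ] (λ _ → + 0)
      fromCollision (i , j , i<j , same) =
        N , ∼-from-difference (B-difference i N) (∼-sym (subst (λ j → B i ∼[ G ] B j) j≡i+N (sameCode⇒∼ same)))
        where
        N : ℕ
        N = j ℕ.∸ suc i
        j≡i+N : j ≡ i ℕ.+ suc N
        j≡i+N = trans (sym (ℕP.m+[n∸m]≡n i<j)) (sym (ℕP.+-suc i N))

≤ᵇ⇒≤ : ∀ {m n} → (m ℕ.≤ᵇ n) ≡ true → m ℕ.≤ n
≤ᵇ⇒≤ {m} {n} eq = ℕP.≤ᵇ⇒≤ m n (subst T (sym eq) _)

≤⇒≤ᵇ : ∀ {m n} → m ℕ.≤ n → (m ℕ.≤ᵇ n) ≡ true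
≤⇒≤ᵇ {m} {n} = dec-true (m ℕ.≤? n)

≰⇒≤ᵇ : ∀ {m n} → ¬ m ℕ.≤ n → (m ℕ.≤ᵇ n) ≡ false
≰⇒≤ᵇ {m} {n} = dec-false (m ℕ.≤? n)

suc-≤ᵇ : ∀ a b → (suc a ℕ.≤ᵇ suc b) ≡ (a ℕ.≤ᵇ b)
suc-≤ᵇ zero    b = refl
suc-≤ᵇ (suc a) b = refl

+-≤ᵇ : ∀ x y z → ((x ℕ.+ y) ℕ.≤ᵇ z) ≡ (x ℕ.≤ᵇ z) ∧ (y ℕ.≤ᵇ (z ℕ.∸ x))
+-≤ᵇ zero    y z       = refl
+-≤ᵇ (suc x) y zero    = refl
+-≤ᵇ (suc x) y (suc z) =
  trans (suc-≤ᵇ (x ℕ.+ y) z) (trans (+-≤ᵇ x y z) (cong (_∧ (y ℕ.≤ᵇ (z ℕ.∸ x))) (sym (suc-≤ᵇ x z))))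

_+V_ : ∀ {k} → Vec ℕ k → Vec ℕ k → Vec ℕ k
_+V_ = Vec.zipWith ℕ._+_

+V-comm : ∀ {k} (a b : Vec ℕ k) → a +V b ≡ b +V a
+V-comm = VecP.zipWith-comm ℕP.+-comm

zeroV-≤V : ∀ {k} (e : Vec ℕ k) → (zeroV ≤V e) ≡ true
zeroV-≤V []      = refl
zeroV-≤V (x ∷ e) = zeroV-≤V e

∸V-zeroV : ∀ {k} (e : Vec ℕ k) → e ∸V zeroV ≡ e
∸V-zeroV []      = refl
∸V-zeroV (x ∷ e) = cong (x ∷_) (∸V-zeroV e)

≤V-refl : ∀ {k} (e : Vec ℕ k) → (e ≤V e) ≡ true
≤V-refl []      = refl
≤V-refl (x ∷ e) = cong₂ _∧_ (≤⇒≤ᵇ (ℕP.≤-refl {x})) (≤V-refl e)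

∸V-self : ∀ {k} (e : Vec ℕ k) → e ∸V e ≡ zeroV
∸V-self []      = refl
∸V-self (x ∷ e) = cong₂ _∷_ (ℕP.n∸n≡0 x) (∸V-self e)

≤V-+V : ∀ {k} (a b e : Vec ℕ k) → ((a +V b) ≤V e) ≡ (a ≤V e) ∧ (b ≤V (e ∸V a))
≤V-+V []      []      []      = refl
≤V-+V (x ∷ a) (y ∷ b) (z ∷ e) rewrite ≤V-+V a b e | +-≤ᵇ x y z =
  ∧-interchange (x ℕ.≤ᵇ z) (y ℕ.≤ᵇ (z ℕ.∸ x)) (a ≤V e) (b ≤V (e ∸V a))
  where
  ∧-interchange : ∀ p q r s → (p ∧ q) ∧ (r ∧ s) ≡ (p ∧ r) ∧ (q ∧ s)
  ∧-interchange true  q true  s = refl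
  ∧-interchange true  q false s = BoolP.∧-zeroʳ q
  ∧-interchange false q r     s = refl

∸V-+V : ∀ {k} (a b e : Vec ℕ k) → e ∸V (a +V b) ≡ (e ∸V a) ∸V b
∸V-+V []      []      []      = refl
∸V-+V (x ∷ a) (y ∷ b) (z ∷ e) = cong₂ _∷_ (sym (ℕP.∸-+-assoc z x y)) (∸V-+V a b e)

≤V-∸V-zero⇒≡ : ∀ {k} (m e : Vec ℕ k) → (m ≤V e) ≡ true → e ∸V m ≡ zeroV → m ≡ e
≤V-∸V-zero⇒≡ []      []      _   _  = refl
≤V-∸V-zero⇒≡ (x ∷ m) (z ∷ e) m≤e e∸m≡0 =
  cong₂ _∷_ (ℕP.≤-antisym (≤ᵇ⇒≤ (∧-fst m≤e)) (ℕP.m∸n≡0⇒m≤n (cong Vec.head e∸m≡0)))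
            (≤V-∸V-zero⇒≡ m e (∧-snd (x ℕ.≤ᵇ z) m≤e) (cong Vec.tail e∸m≡0))
  where
  ∧-fst : ∀ {a b} → a ∧ b ≡ true → a ≡ true
  ∧-fst {true} _ = refl
  ∧-snd : ∀ a {b} → a ∧ b ≡ true → b ≡ true
  ∧-snd true eq = eq

==V⇒≡ : ∀ {k} {x y : Vec ℕ k} → (x ==V y) ≡ true → x ≡ y
==V⇒≡ {x = x} {y} = witness (VecP.≡-dec ℕ._≟_ x y)
  where
  witness : ∀ {P : Set} (d : Dec P) → does d ≡ true → P
  witness (yes p) _ = p

==V-refl : ∀ {k} (x : Vec ℕ k) → (x ==V x) ≡ true
==V-refl x = dec-true (VecP.≡-dec ℕ._≟_ x x) refl

≢⇒==V : ∀ {k} {x y : Vec ℕ k} → x ≢ y → (x ==V y) ≡ false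
≢⇒==V {x = x} {y} = dec-false (VecP.≡-dec ℕ._≟_ x y)

mulMonomial : ∀ {k} → ℤ × Vec ℕ k → Series k → Series k
mulMonomial (c , m) S e = if m ≤V e then c * S (e ∸V m) else + 0

mulMonomial-cong : ∀ {k} t {S S′ : Series k} → (∀ e → S e ≡ S′ e) → ∀ e → mulMonomial t S e ≡ mulMonomial t S′ e
mulMonomial-cong (c , m) S≗S′ e with m ≤V e
... | true  = cong (c *_) (S≗S′ _)
... | false = refl

mulMonomial-+ : ∀ {k} t (A B : Series k) e → mulMonomial t (λ e → A e + B e) e ≡ mulMonomial t A e + mulMonomial t B e
mulMonomial-+ (c , m) A B e with m ≤V e
... | true  = ℤP.*-distribˡ-+ c _ _
... | false = refl

mulMonomial-zero : ∀ {k} t (e : Vec ℕ k) → mulMonomial t (λ _ → + 0) e ≡ + 0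
mulMonomial-zero (c , m) e with m ≤V e
... | true  = ℤP.*-zeroʳ c
... | false = refl

mulMonomial-mulMonomial : ∀ {k} c (m : Vec ℕ k) c′ m′ S e →
  mulMonomial (c , m) (mulMonomial (c′ , m′) S) e ≡ mulMonomial (c * c′ , m +V m′) S e
mulMonomial-mulMonomial c m c′ m′ S e rewrite ≤V-+V m m′ e | ∸V-+V m m′ e with m ≤V e
... | false = refl
... | true with m′ ≤V (e ∸V m)
...   | true  = sym (ℤP.*-assoc c c′ _)
...   | false = ℤP.*-zeroʳ c

mulMonomial-comm : ∀ {k} t t′ (S : Series k) e → mulMonomial t (mulMonomial t′ S) e ≡ mulMonomial t′ (mulMonomial t S) e
mulMonomial-comm (c , m) (c′ , m′) S e
  rewrite mulMonomial-mulMonomial c m c′ m′ S e | mulMonomial-mulMonomial c′ m′ c m S e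
        | +V-comm m m′ | ℤP.*-comm c c′ = refl

mulCoeff-cong : ∀ {k} (h : Poly k) {S S′ : Series k} → (∀ e → S e ≡ S′ e) → ∀ e → mulCoeff h S e ≡ mulCoeff h S′ e
mulCoeff-cong []      S≗S′ e = refl
mulCoeff-cong (t ∷ h) S≗S′ e = cong₂ _+_ (mulMonomial-cong t S≗S′ e) (mulCoeff-cong h S≗S′ e)

mulCoeff-+ : ∀ {k} (h : Poly k) (A B : Series k) e → mulCoeff h (λ e → A e + B e) e ≡ mulCoeff h A e + mulCoeff h B e
mulCoeff-+ []      A B e = refl
mulCoeff-+ (t ∷ h) A B e =
  trans (cong₂ _+_ (mulMonomial-+ t A B e) (mulCoeff-+ h A B e))
        (interchange (mulMonomial t A e) (mulMonomial t B e) (mulCoeff h A e) (mulCoeff h B e))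
  where
  interchange : ∀ a b c d → (a + b) + (c + d) ≡ (a + c) + (b + d)
  interchange = solve-∀

mulCoeff-zero : ∀ {k} (h : Poly k) e → mulCoeff h (λ _ → + 0) e ≡ + 0
mulCoeff-zero []      e = refl
mulCoeff-zero (t ∷ h) e = cong₂ _+_ (mulMonomial-zero t e) (mulCoeff-zero h e)

mulCoeff-++ : ∀ {k} (h h′ : Poly k) S e → mulCoeff (h ++ h′) S e ≡ mulCoeff h S e + mulCoeff h′ S e
mulCoeff-++ []      h′ S e = sym (ℤP.+-identityˡ _)
mulCoeff-++ (t ∷ h) h′ S e =
  trans (cong (_+_ (mulMonomial t S e)) (mulCoeff-++ h h′ S e)) (sym (ℤP.+-assoc (mulMonomial t S e) _ _))

coeff-++ : ∀ {k} (h h′ : Poly k) e → coeff (h ++ h′) e ≡ coeff h e + coeff h′ e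
coeff-++ []            h′ e = sym (ℤP.+-identityˡ _)
coeff-++ ((c , m) ∷ h) h′ e =
  trans (cong (_+_ (if m ==V e then c else + 0)) (coeff-++ h h′ e)) (sym (ℤP.+-assoc (if m ==V e then c else + 0) _ _))

mulMonomial-mulCoeff : ∀ {k} t (p : Poly k) S e → mulMonomial t (mulCoeff p S) e ≡ mulCoeff p (mulMonomial t S) e
mulMonomial-mulCoeff t []       S e = mulMonomial-zero t e
mulMonomial-mulCoeff t (t′ ∷ p) S e =
  trans (mulMonomial-+ t (mulMonomial t′ S) (mulCoeff p S) e)
        (cong₂ _+_ (mulMonomial-comm t t′ S e) (mulMonomial-mulCoeff t p S e))

mulCoeff-comm : ∀ {k} (h p : Poly k) S e → mulCoeff h (mulCoeff p S) e ≡ mulCoeff p (mulCoeff h S) e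
mulCoeff-comm []      p S e = sym (mulCoeff-zero p e)
mulCoeff-comm (t ∷ h) p S e =
  trans (cong₂ _+_ (mulMonomial-mulCoeff t p S e) (mulCoeff-comm h p S e))
        (sym (mulCoeff-+ p (mulMonomial t S) (mulCoeff h S) e))

_·ₘ_ : ∀ {k} → ℤ × Vec ℕ k → Poly k → Poly k
t       ·ₘ []               = []
(c , m) ·ₘ ((c′ , m′) ∷ p) = (c * c′ , m +V m′) ∷ ((c , m) ·ₘ p)

mulCoeff-·ₘ : ∀ {k} t (p : Poly k) S e → mulCoeff (t ·ₘ p) S e ≡ mulMonomial t (mulCoeff p S) e
mulCoeff-·ₘ t             []              S e = sym (mulMonomial-zero t e)
mulCoeff-·ₘ t@(c , m)     ((c′ , m′) ∷ p) S e =
  trans (cong₂ _+_ (sym (mulMonomial-mulMonomial c m c′ m′ S e)) (mulCoeff-·ₘ t p S e))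
        (sym (mulMonomial-+ t (mulMonomial (c′ , m′) S) (mulCoeff p S) e))

_*ᴾ_ : ∀ {k} → Poly k → Poly k → Poly k
[]      *ᴾ q = []
(t ∷ p) *ᴾ q = (t ·ₘ q) ++ (p *ᴾ q)

mulCoeff-*ᴾ : ∀ {k} (p q : Poly k) S e → mulCoeff (p *ᴾ q) S e ≡ mulCoeff p (mulCoeff q S) e
mulCoeff-*ᴾ []      q S e = refl
mulCoeff-*ᴾ (t ∷ p) q S e = trans (mulCoeff-++ (t ·ₘ q) (p *ᴾ q) S e) (cong₂ _+_ (mulCoeff-·ₘ t q S e) (mulCoeff-*ᴾ p q S e))

oneSeries : ∀ {k} → Series k
oneSeries e = if e ==V zeroV then + 1 else + 0

oneSeries-zeroV : ∀ {k} → oneSeries {k} zeroV ≡ + 1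
oneSeries-zeroV {k} = cong (λ b → if b then + 1 else + 0) (==V-refl (zeroV {k}))

coeff-as-mulCoeff : ∀ {k} (f : Poly k) e → coeff f e ≡ mulCoeff f oneSeries e
coeff-as-mulCoeff []            e = refl
coeff-as-mulCoeff {k} ((c , m) ∷ f) e = cong₂ _+_ (monomial m e) (coeff-as-mulCoeff f e)
  where
  monomial : ∀ m e → (if m ==V e then c else + 0) ≡ mulMonomial (c , m) oneSeries e
  monomial m e with VecP.≡-dec ℕ._≟_ m e
  ... | yes refl rewrite ≤V-refl m | ∸V-self m = sym (trans (cong (c *_) (oneSeries-zeroV {k})) (ℤP.*-identityʳ c))
  ... | no m≢e with m ≤V e in m≤e
  ...   | false = refl
  ...   | true with (e ∸V m) ==V zeroV in e∸m≡0
  ...     | true  = ⊥-elim (m≢e (≤V-∸V-zero⇒≡ m e m≤e (==V⇒≡ e∸m≡0)))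
  ...     | false = sym (ℤP.*-zeroʳ c)

coeff-*ᴾ : ∀ {k} (p q : Poly k) e → coeff (p *ᴾ q) e ≡ mulCoeff p (coeff q) e
coeff-*ᴾ p q e = trans (coeff-as-mulCoeff (p *ᴾ q) e)
                       (trans (mulCoeff-*ᴾ p q oneSeries e) (mulCoeff-cong p (λ e → sym (coeff-as-mulCoeff q e)) e))

≤V-zeroV : ∀ {k} (m : Vec ℕ k) → (m ≤V zeroV) ≡ (m ==V zeroV)
≤V-zeroV []          = refl
≤V-zeroV (zero  ∷ m) = ≤V-zeroV m
≤V-zeroV (suc x ∷ m) = refl

zeroV-∸V : ∀ {k} (m : Vec ℕ k) → zeroV ∸V m ≡ zeroV
zeroV-∸V []      = refl
zeroV-∸V (x ∷ m) = cong₂ _∷_ (ℕP.0∸n≡0 x) (zeroV-∸V m)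

mulCoeff-zeroV : ∀ {k} (p : Poly k) S → mulCoeff p S zeroV ≡ coeff p zeroV * S zeroV
mulCoeff-zeroV []            S = refl
mulCoeff-zeroV ((c , m) ∷ p) S =
  trans (cong₂ _+_ monomial (mulCoeff-zeroV p S)) (sym (ℤP.*-distribʳ-+ (S zeroV) (if m ==V zeroV then c else + 0) (coeff p zeroV)))
  where
  monomial : mulMonomial (c , m) S zeroV ≡ (if m ==V zeroV then c else + 0) * S zeroV
  monomial rewrite ≤V-zeroV m | zeroV-∸V m with m ==V zeroV
  ... | true  = refl
  ... | false = sym (ℤP.*-zeroˡ (S zeroV))

coeff-*ᴾ-zeroV : ∀ {k} (p q : Poly k) → coeff (p *ᴾ q) zeroV ≡ coeff p zeroV * coeff q zeroV
coeff-*ᴾ-zeroV p q = trans (coeff-*ᴾ p q zeroV) (mulCoeff-zeroV p (coeff q))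

Rational : ∀ {k} → Series k → Set
Rational {k} S = Σ (Poly k) λ f → Σ (Poly k) λ h → coeff h zeroV ≢ + 0 × (∀ e → mulCoeff h S e ≡ coeff f e)

*-≢0 : ∀ {x y : ℤ} → x ≢ + 0 → y ≢ + 0 → x * y ≢ + 0
*-≢0 {x} x≢0 y≢0 xy≡0 with ℤP.i*j≡0⇒i≡0∨j≡0 x xy≡0
... | inj₁ x≡0 = x≢0 x≡0
... | inj₂ y≡0 = y≢0 y≡0

rational-ext : ∀ {k} {S S′ : Series k} → (∀ e → S e ≡ S′ e) → Rational S → Rational S′
rational-ext S≗S′ (f , h , h₀≢0 , hS≡f) = f , h , h₀≢0 , λ e → trans (sym (mulCoeff-cong h S≗S′ e)) (hS≡f e)

one : ∀ {k} → Poly k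
one = (+ 1 , zeroV) ∷ []

coeff-one : ∀ {k} → coeff (one {k}) zeroV ≢ + 0
coeff-one {k} eq with trans (cong (λ b → (if b then + 1 else + 0) + + 0) (sym (==V-refl (zeroV {k})))) eq
... | ()

rational-zero : ∀ {k} → Rational {k} (λ _ → + 0)
rational-zero {k} = [] , one , coeff-one {k} , λ e → mulCoeff-zero (one {k}) e

rational-+ : ∀ {k} {S T : Series k} → Rational S → Rational T → Rational (λ e → S e + T e)
rational-+ {S = S} {T} (f₁ , h₁ , h₁≢0 , h₁S≡f₁) (f₂ , h₂ , h₂≢0 , h₂T≡f₂) =
  (h₂ *ᴾ f₁) ++ (h₁ *ᴾ f₂) , h₁ *ᴾ h₂ ,
  (λ eq → *-≢0 h₁≢0 h₂≢0 (trans (sym (coeff-*ᴾ-zeroV h₁ h₂)) eq)) , sum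
  where
  sum : ∀ e → mulCoeff (h₁ *ᴾ h₂) (λ e → S e + T e) e ≡ coeff ((h₂ *ᴾ f₁) ++ (h₁ *ᴾ f₂)) e
  sum e = begin
    mulCoeff (h₁ *ᴾ h₂) (λ e → S e + T e) e
      ≡⟨ mulCoeff-*ᴾ h₁ h₂ _ e ⟩
    mulCoeff h₁ (mulCoeff h₂ (λ e → S e + T e)) e
      ≡⟨ mulCoeff-cong h₁ (mulCoeff-+ h₂ S T) e ⟩
    mulCoeff h₁ (λ e → mulCoeff h₂ S e + mulCoeff h₂ T e) e
      ≡⟨ mulCoeff-+ h₁ (mulCoeff h₂ S) (mulCoeff h₂ T) e ⟩
    mulCoeff h₁ (mulCoeff h₂ S) e + mulCoeff h₁ (mulCoeff h₂ T) e
      ≡⟨ cong₂ _+_ (trans (mulCoeff-comm h₁ h₂ S e) (trans (mulCoeff-cong h₂ h₁S≡f₁ e) (sym (coeff-*ᴾ h₂ f₁ e))))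
                   (trans (mulCoeff-cong h₁ h₂T≡f₂ e) (sym (coeff-*ᴾ h₁ f₂ e))) ⟩
    coeff (h₂ *ᴾ f₁) e + coeff (h₁ *ᴾ f₂) e
      ≡⟨ coeff-++ (h₂ *ᴾ f₁) (h₁ *ᴾ f₂) e ⟨
    coeff ((h₂ *ᴾ f₁) ++ (h₁ *ᴾ f₂)) e ∎
    where open ≡-Reasoning

rational-mulCoeff : ∀ {k} (p : Poly k) {S : Series k} → Rational S → Rational (mulCoeff p S)
rational-mulCoeff p {S} (f , h , h₀≢0 , hS≡f) =
  p *ᴾ f , h , h₀≢0 , λ e → trans (mulCoeff-comm h p S e) (trans (mulCoeff-cong p hS≡f e) (sym (coeff-*ᴾ p f e)))

rational-cancel : ∀ {k} (p : Poly k) {S : Series k} → coeff p zeroV ≢ + 0 → Rational (mulCoeff p S) → Rational S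
rational-cancel p {S} p₀≢0 (f , h , h₀≢0 , hpS≡f) =
  f , h *ᴾ p , (λ eq → *-≢0 h₀≢0 p₀≢0 (trans (sym (coeff-*ᴾ-zeroV h p)) eq)) ,
  λ e → trans (mulCoeff-*ᴾ h p S e) (hpS≡f e)

rational-scale : ∀ {k} (c : ℤ) {S : Series k} → Rational S → Rational (λ e → c * S e)
rational-scale c {S} = rational-ext constant ∘ rational-mulCoeff ((c , zeroV) ∷ [])
  where
  constant : ∀ e → mulCoeff ((c , zeroV) ∷ []) S e ≡ c * S e
  constant e rewrite zeroV-≤V e | ∸V-zeroV e = ℤP.+-identityʳ _

rational-in-no-variables : ∀ (S : Series 0) → Rational S
rational-in-no-variables S = ((S [] , []) ∷ []) , one , coeff-one {0} , λ { [] → constant }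
  where
  constant : + 1 * S [] + + 0 ≡ S [] + + 0
  constant = cong (_+ + 0) (ℤP.*-identityˡ (S []))

-- Slicing a power series along one variable

insertAt-≤V : ∀ {k} (x y : Vec ℕ k) j a b → (insertAt x j a ≤V insertAt y j b) ≡ (a ℕ.≤ᵇ b) ∧ (x ≤V y)
insertAt-≤V x        y        zero    a b = refl
insertAt-≤V (x₀ ∷ x) (y₀ ∷ y) (suc j) a b rewrite insertAt-≤V x y j a b =
  ∧-swap (x₀ ℕ.≤ᵇ y₀) (a ℕ.≤ᵇ b) (x ≤V y)
  where
  ∧-swap : ∀ p q r → p ∧ (q ∧ r) ≡ q ∧ (p ∧ r)
  ∧-swap true  q r = refl
  ∧-swap false q r = sym (BoolP.∧-zeroʳ q)

insertAt-==V : ∀ {k} (x y : Vec ℕ k) j a b → (insertAt x j a ==V insertAt y j b) ≡ does (a ℕ.≟ b) ∧ (x ==V y)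
insertAt-==V x        y        zero    a b = refl
insertAt-==V (x₀ ∷ x) (y₀ ∷ y) (suc j) a b rewrite insertAt-==V x y j a b =
  ∧-swap (does (x₀ ℕ.≟ y₀)) (does (a ℕ.≟ b)) (x ==V y)
  where
  ∧-swap : ∀ p q r → p ∧ (q ∧ r) ≡ q ∧ (p ∧ r)
  ∧-swap true  q r = refl
  ∧-swap false q r = sym (BoolP.∧-zeroʳ q)

insertAt-∸V : ∀ {k} (x y : Vec ℕ k) j a b → insertAt x j a ∸V insertAt y j b ≡ insertAt (x ∸V y) j (a ℕ.∸ b)
insertAt-∸V x        y        zero    a b = refl
insertAt-∸V (x₀ ∷ x) (y₀ ∷ y) (suc j) a b = cong (x₀ ℕ.∸ y₀ ∷_) (insertAt-∸V x y j a b)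

insertAt-zeroV : ∀ {k} (j : Fin (suc k)) → insertAt zeroV j 0 ≡ zeroV
insertAt-zeroV         zero    = refl
insertAt-zeroV {suc k} (suc j) = cong (0 ∷_) (insertAt-zeroV j)

module _ {k : ℕ} (j : Fin (suc k)) where

  slab : ℕ → Series (suc k) → Series k
  slab c S e = S (insertAt e j c)

  embedAt : ℕ → Series k → Series (suc k)
  embedAt c T e = ⟦ does (c ℕ.≟ lookup e j) ⟧ T (removeAt e j)

  liftPoly : ℕ → Poly k → Poly (suc k)
  liftPoly c []            = []
  liftPoly c ((a , m) ∷ p) = (a , insertAt m j c) ∷ liftPoly c p

  coeff-liftPoly : ∀ c f x e → coeff (liftPoly c f) (insertAt e j x) ≡ ⟦ does (c ℕ.≟ x) ⟧ coeff f e
  coeff-liftPoly c []            x e = sym (⟦⟧-zero (does (c ℕ.≟ x)))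
  coeff-liftPoly c ((a , m) ∷ f) x e rewrite insertAt-==V m e j c x =
    trans (cong (_+_ (⟦ does (c ℕ.≟ x) ∧ (m ==V e) ⟧ a)) (coeff-liftPoly c f x e)) (select (does (c ℕ.≟ x)) (m ==V e))
    where
    select : ∀ d q → ⟦ d ∧ q ⟧ a + ⟦ d ⟧ coeff f e ≡ ⟦ d ⟧ (⟦ q ⟧ a + coeff f e)
    select true  q = refl
    select false q = refl

  mulCoeff-liftPoly : ∀ c h (T : Series k) x e →
    mulCoeff (liftPoly 0 h) (embedAt c T) (insertAt e j x) ≡ ⟦ does (c ℕ.≟ x) ⟧ mulCoeff h T e
  mulCoeff-liftPoly c []            T x e = sym (⟦⟧-zero (does (c ℕ.≟ x)))
  mulCoeff-liftPoly c ((a , m) ∷ h) T x e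
    rewrite insertAt-≤V m e j 0 x | insertAt-∸V e m j x 0
          | VecP.insertAt-lookup (e ∸V m) j x | VecP.removeAt-insertAt (e ∸V m) j x =
    trans (cong₂ _+_ (select (m ≤V e) (does (c ℕ.≟ x))) (mulCoeff-liftPoly c h T x e))
          (⟦⟧-+ (does (c ℕ.≟ x)) (mulMonomial (a , m) T e) (mulCoeff h T e))
    where
    select : ∀ p d → (if p then a * (⟦ d ⟧ T (e ∸V m)) else + 0) ≡ ⟦ d ⟧ (if p then a * T (e ∸V m) else + 0)
    select true  true  = refl
    select true  false = ℤP.*-zeroʳ a
    select false d     = sym (⟦⟧-zero d)

  rational-embedAt : ∀ c {T} → Rational T → Rational (embedAt c T)
  rational-embedAt c {T} (f , h , h₀≢0 , hT≡f) = liftPoly c f , liftPoly 0 h , lifted₀≢0 , lifted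
    where
    lifted₀≢0 : coeff (liftPoly 0 h) zeroV ≢ + 0
    lifted₀≢0 eq = h₀≢0 (trans (sym (coeff-liftPoly 0 h 0 zeroV)) (trans (cong (coeff (liftPoly 0 h)) (insertAt-zeroV j)) eq))
    lifted : ∀ e → mulCoeff (liftPoly 0 h) (embedAt c T) e ≡ coeff (liftPoly c f) e
    lifted e = subst (λ e → mulCoeff (liftPoly 0 h) (embedAt c T) e ≡ coeff (liftPoly c f) e) (VecP.insertAt-removeAt e j)
      (trans (mulCoeff-liftPoly c h T (lookup e j) (removeAt e j))
             (trans (cong (⟦ does (c ℕ.≟ lookup e j) ⟧_) (hT≡f (removeAt e j)))
                    (sym (coeff-liftPoly c f (lookup e j) (removeAt e j)))))

  truncate : ℕ → Series (suc k) → Series (suc k)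
  truncate M S e = if M ℕ.≤ᵇ lookup e j then + 0 else S e

  truncate-suc : ∀ M S e → truncate (suc M) S e ≡ embedAt M (slab M S) e + truncate M S e
  truncate-suc M S e with ℕP.<-cmp (lookup e j) M
  ... | tri< x<M x≢M _ rewrite ≰⇒≤ᵇ (ℕP.<⇒≱ (ℕP.m<n⇒m<1+n x<M)) | dec-false (M ℕ.≟ lookup e j) (x≢M ∘ sym)
                             | ≰⇒≤ᵇ (ℕP.<⇒≱ x<M) = sym (ℤP.+-identityˡ (S e))
  ... | tri≈ _ x≡M _ rewrite ≰⇒≤ᵇ (ℕP.<⇒≱ (subst (ℕ._< suc M) (sym x≡M) (ℕP.n<1+n M))) | sym x≡M
                           | dec-true (lookup e j ℕ.≟ lookup e j) refl | ≤⇒≤ᵇ (ℕP.≤-refl {lookup e j})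
                           | VecP.insertAt-removeAt e j = sym (ℤP.+-identityʳ (S e))
  ... | tri> _ x≢M M<x rewrite ≤⇒≤ᵇ M<x | dec-false (M ℕ.≟ lookup e j) (x≢M ∘ sym) | ≤⇒≤ᵇ (ℕP.<⇒≤ M<x) = refl

  rational-truncate : ∀ M S → (∀ c → c ℕ.< M → Rational (slab c S)) → Rational (truncate M S)
  rational-truncate zero    S slabs = rational-ext (λ _ → refl) rational-zero
  rational-truncate (suc M) S slabs =
    rational-ext (λ e → sym (truncate-suc M S e))
      (rational-+ (rational-embedAt M (slabs M (ℕP.n<1+n M)))
                  (rational-truncate M S (λ c c<M → slabs c (ℕP.m<n⇒m<1+n c<M))))

  rational-slabs : ∀ M S → (∀ e → M ℕ.≤ lookup e j → S e ≡ + 0) →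
                   (∀ c → c ℕ.< M → Rational (slab c S)) → Rational S
  rational-slabs M S vanish slabs = rational-ext truncated (rational-truncate M S slabs)
    where
    truncated : ∀ e → truncate M S e ≡ S e
    truncated e with M ℕ.≤? lookup e j
    ... | yes M≤x rewrite ≤⇒≤ᵇ M≤x = sym (vanish e M≤x)
    ... | no  M≰x rewrite ≰⇒≤ᵇ M≰x = refl

headPoly : ∀ {k} → List (ℤ × ℕ) → Poly (suc k)
headPoly []            = []
headPoly ((a , N) ∷ l) = (a , N ∷ zeroV) ∷ headPoly l

rational-slab-headPoly : ∀ {k} (l : List (ℤ × ℕ)) (Q : Series (suc k)) →
  (∀ c → Rational (slab zero c Q)) → ∀ c → Rational (slab zero c (mulCoeff (headPoly l) Q))
rational-slab-headPoly []            Q slabs c = rational-zero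
rational-slab-headPoly ((a , N) ∷ l) Q slabs c =
  rational-+ (rational-ext (λ e → sym (shifted e)) (guarded (N ℕ.≤ᵇ c))) (rational-slab-headPoly l Q slabs c)
  where
  shifted : ∀ e → mulMonomial (a , N ∷ zeroV) Q (c ∷ e) ≡ (if N ℕ.≤ᵇ c then a * Q ((c ℕ.∸ N) ∷ e) else + 0)
  shifted e rewrite zeroV-≤V e | ∸V-zeroV e | BoolP.∧-identityʳ (N ℕ.≤ᵇ c) = refl
  guarded : ∀ b → Rational (λ e → if b then a * Q ((c ℕ.∸ N) ∷ e) else + 0)
  guarded true  = rational-scale a (slabs (c ℕ.∸ N))
  guarded false = rational-zero

square₀-terms : List (ℤ × ℕ)
square₀-terms = (+ 1 , 0) ∷ (-[1+ 1 ] , 1) ∷ (+ 1 , 2) ∷ []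

square₀ : ∀ {k} → Poly (suc k)
square₀ = headPoly square₀-terms

coeff-square₀ : ∀ {k} → coeff (square₀ {k}) zeroV ≢ + 0
coeff-square₀ {k} eq with trans (sym (cong (λ b → (if b then + 1 else + 0) + (+ 0 + (+ 0 + + 0))) (==V-refl (zeroV {suc k})))) eq
... | ()

mulCoeff-square₀-affine : ∀ {k} (Q : Series (suc k)) (α : Vec ℕ k → ℤ) d M →
  (∀ c e → M ℕ.≤ c → Q (c ∷ e) ≡ α e + + c * d) → ∀ e → 2 ℕ.+ M ℕ.≤ lookup e zero → mulCoeff square₀ Q e ≡ + 0
mulCoeff-square₀-affine Q α d M affine (suc (suc c) ∷ e) (s≤s (s≤s M≤c))
  rewrite zeroV-≤V e | ∸V-zeroV e | affine c e M≤c | affine (suc c) e (ℕP.m≤n⇒m≤1+n M≤c)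
        | affine (suc (suc c)) e (ℕP.m≤n⇒m≤1+n (ℕP.m≤n⇒m≤1+n M≤c)) = second-difference (α e) (+ c) d
  where
  second-difference : ∀ a c d → + 1 * (a + (+ 2 + c) * d) + (-[1+ 1 ] * (a + (+ 1 + c) * d) + (+ 1 * (a + c * d) + + 0)) ≡ + 0
  second-difference = solve-∀

oneMinus : ∀ {k} → Vec ℕ k → Poly k
oneMinus v = (+ 1 , zeroV) ∷ (-[1+ 0 ] , v) ∷ []

coeff-oneMinus : ∀ {k} (v : Vec ℕ k) → v ≢ zeroV → coeff (oneMinus v) zeroV ≢ + 0
coeff-oneMinus {k} v v≢0 eq
  with trans (sym (cong₂ (λ p q → (if p then + 1 else + 0) + ((if q then -[1+ 0 ] else + 0) + + 0))
                         (==V-refl (zeroV {k})) (≢⇒==V v≢0))) eq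
... | ()

mulCoeff-oneMinus : ∀ {k} v (S : Series k) → (∀ e → (v ≤V e) ≡ true → S e ≡ S (e ∸V v)) →
                    ∀ e → mulCoeff (oneMinus v) S e ≡ (if v ≤V e then + 0 else S e)
mulCoeff-oneMinus v S periodic e rewrite zeroV-≤V e | ∸V-zeroV e with v ≤V e in v≤e
... | true  = trans (cong (λ s → + 1 * s + (-[1+ 0 ] * S (e ∸V v) + + 0)) (periodic e v≤e)) (cancel (S (e ∸V v)))
  where
  cancel : ∀ s → + 1 * s + (-[1+ 0 ] * s + + 0) ≡ + 0
  cancel = solve-∀
... | false = trans (ℤP.+-identityʳ _) (ℤP.*-identityˡ (S e))

linComb-zeroV : ∀ {n k} (Ds : Vec (Divisor n) k) u → linComb zeroV Ds u ≡ + 0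
linComb-zeroV []       u = refl
linComb-zeroV (D ∷ Ds) u = trans (cong (_+_ (+ 0 * D u)) (linComb-zeroV Ds u)) (trans (ℤP.+-identityʳ _) (ℤP.*-zeroˡ (D u)))

linComb-insertAt : ∀ {n k} (Ds : Vec (Divisor n) (suc k)) e j c u →
  linComb (insertAt e j c) Ds u ≡ + c * lookup Ds j u + linComb e (removeAt Ds j) u
linComb-insertAt (D ∷ Ds)      e        zero    c u = refl
linComb-insertAt (D ∷ D′ ∷ Ds) (x ∷ e) (suc j) c u =
  trans (cong (_+_ (+ x * D u)) (linComb-insertAt (D′ ∷ Ds) e j c u)) (swap (+ x * D u) (+ c * lookup (D′ ∷ Ds) j u) _)
  where
  swap : ∀ a b r → a + (b + r) ≡ b + (a + r)
  swap = solve-∀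

linComb-unit : ∀ {n k} (Ds : Vec (Divisor n) k) j b u → linComb (zeroV [ j ]≔ b) Ds u ≡ + b * lookup Ds j u
linComb-unit (D ∷ Ds) zero    b u = trans (cong (_+_ (+ b * D u)) (linComb-zeroV Ds u)) (ℤP.+-identityʳ _)
linComb-unit (D ∷ Ds) (suc j) b u =
  trans (cong₂ _+_ (ℤP.*-zeroˡ (D u)) (linComb-unit Ds j b u)) (ℤP.+-identityˡ _)

linComb-∸V : ∀ {n k} (Ds : Vec (Divisor n) k) (v e : Vec ℕ k) → (v ≤V e) ≡ true →
  ∀ u → linComb e Ds u ≡ linComb (e ∸V v) Ds u + linComb v Ds u
linComb-∸V []       []      []      _   u = refl
linComb-∸V (D ∷ Ds) (y ∷ v) (x ∷ e) v≤e u =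
  trans (cong₂ (λ a b → a * D u + b)
               (trans (cong +_ (sym (ℕP.m∸n+n≡m (≤ᵇ⇒≤ {y} {x} (∧-fst (y ℕ.≤ᵇ x) v≤e))))) (ℤP.pos-+ (x ℕ.∸ y) y))
                                     (linComb-∸V Ds v e (∧-snd (y ℕ.≤ᵇ x) v≤e) u))
        (regroup (+ (x ℕ.∸ y)) (+ y) (D u) _ _)
  where
  ∧-fst : ∀ a {b} → a ∧ b ≡ true → a ≡ true
  ∧-fst true _ = refl
  ∧-snd : ∀ a {b} → a ∧ b ≡ true → b ≡ true
  ∧-snd true eq = eq
  regroup : ∀ p q d r s → (p + q) * d + (r + s) ≡ (p * d + r) + (q * d + s)
  regroup = solve-∀

deg-linComb-∷ : ∀ {n k} m (e : Vec ℕ k) D (Ds : Vec (Divisor n) k) →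
  deg (linComb (m ∷ e) (D ∷ Ds)) ≡ + m * deg D + deg (linComb e Ds)
deg-linComb-∷ m e D Ds = trans (sumFin-+ (λ u → + m * D u) (linComb e Ds)) (cong (_+ _) (sumFin-*ˡ (+ m) D))

0≤deg-linComb : ∀ {n k} (e : Vec ℕ k) (Ds : Vec (Divisor n) k) →
  (∀ i → + 0 ≤ deg (lookup Ds i)) → + 0 ≤ deg (linComb e Ds)
0≤deg-linComb {n} []      []       _      = ℤP.≤-reflexive (sym (sumFin-zero n))
0≤deg-linComb     (m ∷ e) (D ∷ Ds) 0≤degs = subst (+ 0 ≤_) (sym (deg-linComb-∷ m e D Ds))
  (ℤP.+-mono-≤ (0≤-* (0≤+ m) (0≤degs zero)) (0≤deg-linComb e Ds (λ i → 0≤degs (suc i))))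

deg-linComb≤0 : ∀ {n k} (e : Vec ℕ k) (Ds : Vec (Divisor n) k) →
  (∀ i → deg (lookup Ds i) ≤ + 0) → deg (linComb e Ds) ≤ + 0
deg-linComb≤0 {n} []      []       _      = ℤP.≤-reflexive (sumFin-zero n)
deg-linComb≤0     (m ∷ e) (D ∷ Ds) degs≤0 = subst (_≤ + 0) (sym (deg-linComb-∷ m e D Ds))
  (ℤP.+-mono-≤ {y = + 0} {v = + 0}
     (≤-by-diff {a = + m * deg D} (flip (+ m) (deg D)) (0≤-* (0≤+ m) (ℤP.i≤j⇒0≤j-i (degs≤0 zero))))
               (deg-linComb≤0 e Ds (λ i → degs≤0 (suc i))))
  where
  flip : ∀ m d → + 0 - m * d ≡ m * (+ 0 - d)
  flip = solve-∀

-- Rank series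

shiftHead : ∀ {k} → ℕ → Series (suc k) → Series (suc k)
shiftHead a S (x ∷ e) = S ((x ℕ.+ a) ∷ e)

unit-≤V : ∀ {k} (j : Fin k) b t → ((zeroV [ j ]≔ b) ≤V t) ≡ (b ℕ.≤ᵇ lookup t j)
unit-≤V zero    b (x ∷ t) rewrite zeroV-≤V t = BoolP.∧-identityʳ _
unit-≤V (suc j) b (x ∷ t) = unit-≤V j b t

-1-injective : ∀ {a b : ℤ} → a - + 1 ≡ b - + 1 → a ≡ b
-1-injective {a} {b} eq = trans (restore a) (trans (cong (_+ + 1) eq) (sym (restore b)))
  where
  restore : ∀ a → a ≡ (a - + 1) + + 1
  restore = solve-∀

opposite-degrees : ∀ d d′ → (+ 0 < d × d′ < + 0) ⊎ (d < + 0 × + 0 < d′) → + ∣ d′ ∣ * d + + ∣ d ∣ * d′ ≡ + 0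
opposite-degrees d d′ (inj₁ (0<d , d′<0)) =
  trans (cong₂ (λ a b → a * d + b * d′) (∣i∣≡-i d′<0) (ℤP.0≤i⇒+∣i∣≡i (ℤP.<⇒≤ 0<d))) (cancel d d′)
  where
  cancel : ∀ d d′ → - d′ * d + d * d′ ≡ + 0
  cancel = solve-∀
opposite-degrees d d′ (inj₂ (d<0 , 0<d′)) =
  trans (cong₂ (λ a b → a * d + b * d′) (ℤP.0≤i⇒+∣i∣≡i (ℤP.<⇒≤ 0<d′)) (∣i∣≡-i d<0)) (cancel d d′)
  where
  cancel : ∀ d d′ → d′ * d + - d * d′ ≡ + 0
  cancel = solve-∀

module _ {n : ℕ} (G : Multigraph (suc n)) (conn : Connected G) where

  RankSeries : ∀ {k} → Divisor (suc n) → Vec (Divisor (suc n)) k → Series k → Set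
  RankSeries B Ds Q = ∀ e → HasRank G (λ u → B u + linComb e Ds u) (Q e - + 1)

  rankSeries-slab : ∀ {k} {B} {Ds : Vec (Divisor (suc n)) (suc k)} {Q} j c → RankSeries B Ds Q →
    RankSeries (λ u → B u + + c * lookup Ds j u) (removeAt Ds j) (slab j c Q)
  rankSeries-slab {B = B} {Ds} j c rankQ e =
    hasRank-resp-≗ {G = G} (λ u → trans (cong (_+_ (B u)) (linComb-insertAt Ds e j c u)) (sym (ℤP.+-assoc (B u) _ _)))
                   (rankQ (insertAt e j c))

  rankSeries-shiftHead : ∀ {k} {B D} {Ds : Vec (Divisor (suc n)) k} {Q} a → RankSeries B (D ∷ Ds) Q →
    RankSeries (λ u → B u + + a * D u) (D ∷ Ds) (shiftHead a Q)
  rankSeries-shiftHead {B = B} {D} {Ds} a rankQ (x ∷ e) = hasRank-resp-≗ {G = G} shifted (rankQ ((x ℕ.+ a) ∷ e))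
    where
    regroup : ∀ b x a d l → b + ((x + a) * d + l) ≡ (b + a * d) + (x * d + l)
    regroup = solve-∀
    shifted : ∀ u → B u + (+ (x ℕ.+ a) * D u + linComb e Ds u) ≡ (B u + + a * D u) + (+ x * D u + linComb e Ds u)
    shifted u = trans (cong (λ m → B u + (m * D u + linComb e Ds u)) (ℤP.pos-+ x a)) (regroup (B u) (+ x) (+ a) (D u) _)

  rankSeries-periodic : ∀ {k} {B} {Ds : Vec (Divisor (suc n)) k} {Q} v → RankSeries B Ds Q →
    (λ u → linComb v Ds u) ∼[ G ] (λ _ → + 0) → ∀ e → (v ≤V e) ≡ true → Q e ≡ Q (e ∸V v)
  rankSeries-periodic {B = B} {Ds} v rankQ v∼0 e v≤e =
    -1-injective (hasRank-resp-∼-unique {G = G} (∼-from-difference difference v∼0) (rankQ e) (rankQ (e ∸V v)))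
    where
    regroup : ∀ b r w → (b + (r + w)) - (b + r) ≡ w - + 0
    regroup = solve-∀
    difference : ∀ u → (B u + linComb e Ds u) - (B u + linComb (e ∸V v) Ds u) ≡ linComb v Ds u - + 0
    difference u = trans (cong (λ l → (B u + l) - (B u + linComb (e ∸V v) Ds u)) (linComb-∸V Ds v e v≤e u))
                         (regroup (B u) (linComb (e ∸V v) Ds u) (linComb v Ds u))

  deg-rankSeries-∷ : ∀ {k} B c e D (Ds : Vec (Divisor (suc n)) k) →
    deg (λ u → B u + linComb (c ∷ e) (D ∷ Ds) u) ≡ deg B + (+ c * deg D + deg (linComb e Ds))
  deg-rankSeries-∷ B c e D Ds = trans (sumFin-+ B (linComb (c ∷ e) (D ∷ Ds))) (cong (_+_ (deg B)) (deg-linComb-∷ c e D Ds))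

  RationalRankSeries : ℕ → Set
  RationalRankSeries k = ∀ B (Ds : Vec (Divisor (suc n)) k) Q → RankSeries B Ds Q → Rational Q

  module _ {k} (IH : RationalRankSeries k) (B D : Divisor (suc n)) (Ds : Vec (Divisor (suc n)) k) (Q : Series (suc k))
           (rankQ : RankSeries B (D ∷ Ds) Q) where

    rational-slab : ∀ c → Rational (slab zero c Q)
    rational-slab c = IH (λ u → B u + + c * D u) Ds (slab zero c Q) (rankSeries-slab {B = B} {Ds = D ∷ Ds} {Q = Q} zero c rankQ)

    -- Since Q has period v, (1 - z^v) Q is Q with its terms above v removed.
    rational-periodic : ∀ v → v ≢ zeroV → (λ u → linComb v (D ∷ Ds) u) ∼[ G ] (λ _ → + 0) →
      Rational (λ e → if v ≤V e then + 0 else Q e) → Rational Q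
    rational-periodic v v≢0 v∼0 truncated =
      rational-cancel (oneMinus v) (coeff-oneMinus v v≢0)
        (rational-ext (λ e → sym (mulCoeff-oneMinus v Q (rankSeries-periodic {B = B} {Ds = D ∷ Ds} {Q = Q} v rankQ v∼0) e)) truncated)

    rational-degree-zero : deg D ≡ + 0 → Rational Q
    rational-degree-zero deg≡0 = rational-periodic v (λ ()) v∼0
      (rational-ext below (rational-truncate zero (suc N) Q (λ c _ → rational-slab c)))
      where
      N : ℕ
      N = proj₁ (torsion G conn D deg≡0)
      v : Vec ℕ (suc k)
      v = suc N ∷ zeroV
      v∼0 : (λ u → linComb v (D ∷ Ds) u) ∼[ G ] (λ _ → + 0)
      v∼0 = ∼-from-difference
              (λ u → cong (_- + 0) (trans (cong (_+_ (+ suc N * D u)) (linComb-zeroV Ds u)) (ℤP.+-identityʳ (+ suc N * D u))))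
              (proj₂ (torsion G conn D deg≡0))
      below : ∀ e → truncate zero (suc N) Q e ≡ (if v ≤V e then + 0 else Q e)
      below (c ∷ e) rewrite zeroV-≤V e | BoolP.∧-identityʳ (suc N ℕ.≤ᵇ c) = refl

    -- With va D + vb Dⱼ ∼ 0, the terms not above v = va e₀ + vb eⱼ are those with
    -- e₀ < va, plus z₀^va times those with eⱼ < vb of Q shifted by va in e₀.
    rational-mixed : ∀ j va vb → va ≢ 0 → (λ u → + va * D u + + vb * lookup Ds j u) ∼[ G ] (λ _ → + 0) → Rational Q
    rational-mixed j va vb va≢0 relation = rational-periodic v (va≢0 ∘ cong Vec.head) v∼0
      (rational-ext (λ e → sym (split e))
        (rational-+ (rational-truncate zero va Q (λ c _ → rational-slab c))
                    (rational-mulCoeff shift (rational-truncate (suc j) vb (shiftHead va Q)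
                      (λ c _ → IH (λ u → (B u + + va * D u) + + c * lookup (D ∷ Ds) (suc j) u)
                                  (removeAt (D ∷ Ds) (suc j)) (slab (suc j) c (shiftHead va Q))
                                  (rankSeries-slab {B = λ u → B u + + va * D u} {Ds = D ∷ Ds} {Q = shiftHead va Q} (suc j) c
                                    (rankSeries-shiftHead {B = B} {D} {Ds} {Q} va rankQ)))))))
      where
      v : Vec ℕ (suc k)
      v = va ∷ (zeroV [ j ]≔ vb)
      v∼0 : (λ u → linComb v (D ∷ Ds) u) ∼[ G ] (λ _ → + 0)
      v∼0 = ∼-from-difference (λ u → cong (λ l → + va * D u + l - + 0) (linComb-unit Ds j vb u)) relation
      shift : Poly (suc k)
      shift = (+ 1 , va ∷ zeroV) ∷ []
      split : ∀ e → (if v ≤V e then + 0 else Q e)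
                  ≡ truncate zero va Q e + mulCoeff shift (truncate (suc j) vb (shiftHead va Q)) e
      split (x ∷ t) rewrite unit-≤V j vb t | zeroV-≤V t | ∸V-zeroV t | BoolP.∧-identityʳ (va ℕ.≤ᵇ x) with va ℕ.≤? x
      ... | no va≰x rewrite ≰⇒≤ᵇ va≰x = sym (ℤP.+-identityʳ (Q (x ∷ t)))
      ... | yes va≤x rewrite ≤⇒≤ᵇ va≤x | ℕP.m∸n+n≡m va≤x with vb ℕ.≤ᵇ lookup t j
      ...   | true  = refl
      ...   | false = sym (trans (ℤP.+-identityˡ _) (trans (ℤP.+-identityʳ _) (ℤP.*-identityˡ _)))

    -- For large e₀ the degree is large, so Q is affine in e₀ and (1 - z₀)² kills it.
    rational-growing : + 0 < deg D → (∀ i → + 0 ≤ deg (lookup Ds i)) → Rational Q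
    rational-growing 0<degD 0≤degs =
      rational-cancel square₀ (coeff-square₀ {k})
        (rational-slabs zero (2 ℕ.+ M) (mulCoeff square₀ Q) (mulCoeff-square₀-affine Q α (deg D) M affine)
                        (λ c _ → rational-slab-headPoly square₀-terms Q rational-slab c))
      where
      M : ℕ
      M = ∣ largeDegree G conn - deg B ∣
      α : Vec ℕ k → ℤ
      α e = deg B + deg (linComb e Ds) - genus G + + 1
      regroup : ∀ b c d s L m → (b + (c * d + s)) - L ≡ (c * (d - (+ 0 + + 1)) + (c - m)) + ((m - (L - b)) + s)
      regroup = solve-∀
      large : ∀ c e → M ℕ.≤ c → largeDegree G conn ≤ deg B + (+ c * deg D + deg (linComb e Ds))
      large c e M≤c = ≤-by-diff (regroup (deg B) (+ c) (deg D) (deg (linComb e Ds)) (largeDegree G conn) (+ M))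
        (ℤP.+-mono-≤ (ℤP.+-mono-≤ (0≤-* (0≤+ c) (ℤP.i≤j⇒0≤j-i (<⇒+1≤ 0<degD))) (ℤP.i≤j⇒0≤j-i (ℤ.+≤+ M≤c)))
                     (ℤP.+-mono-≤ (ℤP.i≤j⇒0≤j-i (i≤∣i∣ (largeDegree G conn - deg B))) (0≤deg-linComb e Ds 0≤degs)))
      rearrange : ∀ q b c d s g → q - + 1 ≡ (b + (c * d + s)) - g → q ≡ (b + s - g + + 1) + c * d
      rearrange q b c d s g eq = trans (restore q) (trans (cong (_+ + 1) eq) (ring b c d s g))
        where
        restore : ∀ q → q ≡ (q - + 1) + + 1
        restore = solve-∀
        ring : ∀ b c d s g → (b + (c * d + s)) - g + + 1 ≡ (b + s - g + + 1) + c * d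
        ring = solve-∀
      affine : ∀ c e → M ℕ.≤ c → Q (c ∷ e) ≡ α e + + c * deg D
      affine c e M≤c = rearrange (Q (c ∷ e)) (deg B) (+ c) (deg D) (deg (linComb e Ds)) (genus G)
        (trans (hasRank-largeDegree G conn _ (subst (largeDegree G conn ≤_) (sym (deg-rankSeries-∷ B c e D Ds)) (large c e M≤c))
                                    (rankQ (c ∷ e)))
               (cong (_- genus G) (deg-rankSeries-∷ B c e D Ds)))

    rational-shrinking : deg D < + 0 → (∀ i → deg (lookup Ds i) ≤ + 0) → Rational Q
    rational-shrinking degD<0 degs≤0 = rational-slabs zero M Q vanish (λ c _ → rational-slab c)
      where
      M : ℕ
      M = suc ∣ deg B ∣
      negative : ∀ c e → M ℕ.≤ c → deg (λ u → B u + linComb (c ∷ e) (D ∷ Ds) u) < + 0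
      negative c e M≤c = subst (_< + 0) (sym (deg-rankSeries-∷ B c e D Ds))
        (<-by-diff (regroup (deg B) (+ c) (deg D) (deg (linComb e Ds)) (+ ∣ deg B ∣))
          (ℤP.+-mono-≤ (ℤP.+-mono-≤ (0≤-* (0≤+ c) (ℤP.i≤j⇒0≤j-i (<⇒+1≤ degD<0))) (ℤP.i≤j⇒0≤j-i (ℤ.+≤+ M≤c)))
                       (ℤP.+-mono-≤ (ℤP.i≤j⇒0≤j-i (i≤∣i∣ (deg B))) (ℤP.i≤j⇒0≤j-i (deg-linComb≤0 e Ds degs≤0)))))
        where
        regroup : ∀ b c d s a → + 0 - ((b + (c * d + s)) + + 1) ≡ (c * (+ 0 - (d + + 1)) + (c - (+ 1 + a))) + ((a - b) + (+ 0 - s))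
        regroup = solve-∀
      vanish : ∀ e → M ℕ.≤ lookup e zero → Q e ≡ + 0
      vanish (c ∷ e) M≤c = -1-injective (hasRank-negDeg {G = G} (negative c e M≤c) (rankQ (c ∷ e)))

    rational-opposite : ∀ j → (+ 0 < deg D × deg (lookup Ds j) < + 0) ⊎ (deg D < + 0 × + 0 < deg (lookup Ds j)) →
                        Rational Q
    rational-opposite j signs = rational-mixed j (suc N ℕ.* a) (suc N ℕ.* b) va≢0 relation
      where
      Dⱼ : Divisor (suc n)
      Dⱼ = lookup Ds j
      a b : ℕ
      a = ∣ deg Dⱼ ∣
      b = ∣ deg D ∣
      Z : Divisor (suc n)
      Z u = + a * D u + + b * Dⱼ u
      degZ : deg Z ≡ + 0
      degZ = trans (sumFin-+ (λ u → + a * D u) (λ u → + b * Dⱼ u))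
                   (trans (cong₂ _+_ (sumFin-*ˡ (+ a) D) (sumFin-*ˡ (+ b) Dⱼ)) (opposite-degrees (deg D) (deg Dⱼ) signs))
      N : ℕ
      N = proj₁ (torsion G conn Z degZ)
      nonzero : (+ 0 < deg D × deg Dⱼ < + 0) ⊎ (deg D < + 0 × + 0 < deg Dⱼ) → deg Dⱼ ≢ + 0
      nonzero (inj₁ (_ , degⱼ<0)) eq = ℤP.<-irrefl eq degⱼ<0
      nonzero (inj₂ (_ , 0<degⱼ)) eq = ℤP.<-irrefl (sym eq) 0<degⱼ
      va≢0 : suc N ℕ.* a ≢ 0
      va≢0 eq with ℕP.m*n≡0⇒m≡0∨n≡0 (suc N) eq
      ... | inj₂ a≡0 = nonzero signs (ℤP.∣i∣≡0⇒i≡0 a≡0)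
      regroup : ∀ m a b x y → ((m * a) * x + (m * b) * y) - + 0 ≡ m * (a * x + b * y) - + 0
      regroup = solve-∀
      relation : (λ u → + (suc N ℕ.* a) * D u + + (suc N ℕ.* b) * Dⱼ u) ∼[ G ] (λ _ → + 0)
      relation = ∼-from-difference
        (λ u → trans (cong₂ (λ p q → (p * D u + q * Dⱼ u) - + 0) (ℤP.pos-* (suc N) a) (ℤP.pos-* (suc N) b))
                     (regroup (+ suc N) (+ a) (+ b) (D u) (Dⱼ u)))
        (proj₂ (torsion G conn Z degZ))

  rationalRankSeries : ∀ k → RationalRankSeries k
  rationalRankSeries zero    B [] Q rankQ = rational-in-no-variables Q
  rationalRankSeries (suc k) B (D ∷ Ds) Q rankQ with ℤP.<-cmp (deg D) (+ 0)
  ... | tri≈ _ deg≡0 _ = rational-degree-zero (rationalRankSeries k) B D Ds Q rankQ deg≡0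
  ... | tri> _ _ 0<deg with FinP.all? (λ i → + 0 ℤ.≤? deg (lookup Ds i))
  ...   | yes 0≤degs = rational-growing (rationalRankSeries k) B D Ds Q rankQ 0<deg 0≤degs
  ...   | no ¬0≤degs = let j , ¬0≤degⱼ = FinP.¬∀⟶∃¬ k _ (λ i → + 0 ℤ.≤? deg (lookup Ds i)) ¬0≤degs
                       in rational-opposite (rationalRankSeries k) B D Ds Q rankQ j (inj₁ (0<deg , ℤP.≰⇒> ¬0≤degⱼ))
  rationalRankSeries (suc k) B (D ∷ Ds) Q rankQ | tri< deg<0 _ _ with FinP.all? (λ i → deg (lookup Ds i) ℤ.≤? + 0)
  ...   | yes degs≤0 = rational-shrinking (rationalRankSeries k) B D Ds Q rankQ deg<0 degs≤0
  ...   | no ¬degs≤0 = let j , ¬degⱼ≤0 = FinP.¬∀⟶∃¬ k _ (λ i → deg (lookup Ds i) ℤ.≤? + 0) ¬degs≤0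
                       in rational-opposite (rationalRankSeries k) B D Ds Q rankQ j (inj₂ (deg<0 , ℤP.≰⇒> ¬degⱼ≤0))

theorem1 : ∀ {n k : ℕ} (G : Multigraph (suc n)) → Connected G
    → (Ds : Vec (Divisor (suc n)) k)
    → (P : Series k)
    → (∀ ns → HasRank G (linComb ns Ds) (P ns - + 1))
    → Σ (Poly k) λ f → Σ (Poly k) λ h →
    coeff h zeroV ≢ + 0 × (∀ e → mulCoeff h P e ≡ coeff f e)
theorem1 {k = k} G conn Ds P rankP =
  rationalRankSeries G conn k (λ _ → + 0) Ds P
    (λ e → hasRank-resp-≗ {G = G} (λ u → sym (ℤP.+-identityˡ (linComb e Ds u))) (rankP e))
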